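{- Let $p$ be an odd prime, $\Lambda_1=\mathbb{F}_p[y_0,y_1]/\langle y_0^p,y_1^p\rangle$, and let $f\in\Lambda_1$ lie in the ideal $\langle y_0,y_1\rangle$. Then \[\sum_{i=0}^{p-1}E_1(f)^i=f^{p-1}-\frac{f^{2p-2}}{(2p-2)!}.\]
   Context: $\mathbb{W}$ denotes the Witt vectors of $\mathbb{F}_p$. For $f\in\langle y_0,y_1\rangle$, choose a lift $\tilde f$ in the ideal $\langle y_0,y_1\rangle$ of $\mathbb{W}[y_0,y_1]/\langle y_0^p,y_1^p\rangle$; $E_1(f)$ is the reduction mod $p$ of $\exp(\tilde f)=\sum_{n\ge0}\tilde f^n/n!$ (which has coefficients in $\mathbb{W}$), and $f^{2p-2}/(2p-2)!$ denotes the reduction mod $p$ of $\tilde f^{2p-2}/(2p-2)!$ (which also has coefficients in $\mathbb{W}$). -}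

module Defs where

open import Data.Nat as ℕ using (ℕ; zero; suc; _∸_; _<_)
open import Data.Nat.Properties using (_!≢0)
open import Data.Nat.Combinatorics using ()
import Data.Nat.Base as NB
open import Data.Integer as ℤ using (ℤ; +_; 0ℤ; 1ℤ)
open import Data.Integer.Divisibility using () renaming (_∣_ to _∣ℤ_)
open import Data.Rational as ℚ using (ℚ; ↥_; ↧ₙ_)

-- A polynomial in y0,y1 over a coefficient type A is represented by its
-- coefficient function  c : ℕ → ℕ → A  (c a b = coefficient of y0^a y1^b).
-- Multiplication is the Cauchy product; the coefficient (a,b) of a product
-- only depends on coefficients (i,j) with i ≤ a, j ≤ b.  The quotient by
-- ⟨y0^p, y1^p⟩ is realised by only ever comparing coefficients with
-- a < p and b < p (see _≈Λ[_]_ below).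

module Trunc {A : Set} (0# 1# : A) (_+_ _*_ : A → A → A) where

  Pol : Set
  Pol = ℕ → ℕ → A

  sumTo : ℕ → (ℕ → A) → A
  sumTo zero    h = 0#
  sumTo (suc n) h = sumTo n h + h n

  _⊕_ : Pol → Pol → Pol
  (f ⊕ g) a b = f a b + g a b

  _⊗_ : Pol → Pol → Pol
  (f ⊗ g) a b = sumTo (suc a) λ i → sumTo (suc b) λ j → f i j * g (a ∸ i) (b ∸ j)

  zeroP : Pol
  zeroP _ _ = 0#

  oneP : Pol
  oneP zero zero = 1#
  oneP _    _    = 0#

  scale : A → Pol → Pol
  scale c f a b = c * f a b

  _^P_ : Pol → ℕ → Pol
  f ^P zero  = oneP
  f ^P suc n = (f ^P n) ⊗ f

  sumP : ℕ → (ℕ → Pol) → Pol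
  sumP zero    F = zeroP
  sumP (suc n) F = sumP n F ⊕ F n

module PZ = Trunc 0ℤ 1ℤ ℤ._+_ ℤ._*_
module PQ = Trunc ℚ.0ℚ ℚ.1ℚ ℚ._+_ ℚ._*_

-- F_p is represented as ℤ modulo the congruence  a ≡ b (mod p).

_≡[_]_ : ℤ → ℕ → ℤ → Set
a ≡[ p ] b = (+ p) ∣ℤ (a ℤ.- b)

_≈Λ[_]_ : PZ.Pol → ℕ → PZ.Pol → Set
f ≈Λ[ p ] g = ∀ a b → a < p → b < p → f a b ≡[ p ] g a b

negP : PZ.Pol → PZ.Pol
negP f a b = ℤ.- f a b

toQ : PZ.Pol → PQ.Pol
toQ f a b = f a b ℚ./ 1

invFact : ℕ → ℚ
invFact n = (1ℤ ℚ./ (n NB.!)) {{n !≢0}}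

-- Reduction mod p of a p-integral rational  q = n/d  (p ∤ d):
-- n · d^(p-2), using d^(p-2) ≡ d^(-1) mod p (Fermat).  This is the
-- reduction map  ℤ_(p) = ℚ ∩ W → F_p  (on p-integral inputs).
redQ : ℕ → ℚ → ℤ
redQ p q = (↥ q) ℤ.* (+ ((↧ₙ q) NB.^ (p ∸ 2)))

redP : ℕ → PQ.Pol → PZ.Pol
redP p F a b = redQ p (F a b)

-- exp(g̃) = Σ_{n ≥ 0} g̃^n / n!  for g̃ with zero constant term in
-- W[y0,y1]/⟨y0^p,y1^p⟩; g̃^n = 0 there for n ≥ 2p-1 (every monomial of
-- degree ≥ 2p-1 vanishes), so the sum is the finite sum over n < 2p-1.
expQ : ℕ → PZ.Pol → PQ.Pol
expQ p g = PQ.sumP (2 ℕ.* p ∸ 1) λ n → PQ.scale (invFact n) (toQ g PQ.^P n)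

-- E_1(f) computed from the integer lift g̃ of f: reduction mod p of exp(g̃).
E₁ : ℕ → PZ.Pol → PZ.Pol
E₁ p g = redP p (expQ p g)

-- f^(2p-2)/(2p-2)!  computed from the lift g̃: reduction of g̃^(2p-2)/(2p-2)!.
powDivFact : ℕ → PZ.Pol → PZ.Pol
powDivFact p g = redP p (PQ.scale (invFact (2 ℕ.* p ∸ 2)) (toQ g PQ.^P (2 ℕ.* p ∸ 2)))

module Submission where

-- Let g be an integer lift of f with g(0,0) = 0 and G = g viewed over ℚ.  In
-- ℚ[y₀,y₁]/⟨y₀^p,y₁^p⟩ every monomial of degree ≥ 2p-1 vanishes, so G^n = 0
-- for n ≥ 2p-1 and exp(G) = Σ_{n ≤ 2p-2} G^n/n!.  The proof has four parts.
--  (1) Exponential powers: exp(G)^i = Σ_n i^n G^n/n!, hence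
--      Σ_{i<p} exp(G)^i = Σ_{n ≤ 2p-2} σₙ · G^n/n!   with σₙ = Σ_{i<p} i^n.
--  (2) p-integrality: each G^n/n! (n ≤ 2p-2) is p-integral.  For n < p the
--      factorial is a unit; for p ≤ n ≤ 2p-2 we have n! = p·m with p ∤ m and
--      g^n ≡ 0 mod p, because g^p ≡ 0 by the Frobenius (y₀^p = y₁^p = 0).
--  (3) Reduction mod p is a ring homomorphism on p-integral rationals, so the
--      reduction of the left side is Σₙ σₙ · red(G^n/n!).
--  (4) Power sums mod p: σ₀ = p ≡ 0 and σₙ ≡ 0 for 0 < n < 2p-2, n ≠ p-1,
--      while σ_{p-1} ≡ σ_{2p-2} ≡ -1; moreover σ_{p-1} ≡ (p-1)! (a
--      finite-difference identity), so the two surviving terms are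
--      (p-1)!·g^(p-1)/(p-1)! = g^(p-1) ≡ f^(p-1)  and  -g^(2p-2)/(2p-2)!.

open import Defs
open import Level using (0ℓ)
open import Algebra.Bundles using (CommutativeRing)
open import Algebra.Structures using (IsCommutativeRing)
import Algebra.Properties.CommutativeSemigroup as CommSemigroupProps
import Algebra.Properties.Ring as RingProps
import Algebra.Solver.Ring.NaturalCoefficients.Default as NatCoeffSolver
open import Data.Nat as ℕ using (ℕ; zero; suc; _∸_; _<_; _≤_; z≤n; s≤s; _<?_; _!)
import Data.Nat.Properties as ℕP
import Data.Nat.Divisibility as ℕD
open import Data.Nat.Coprimality using (Coprime; coprime?)
open import Data.Nat.DivMod using (_%_; _/_; m≡m%n+[m/n]*n; m%n<n)
open import Data.Nat.Primality using (Prime; composite; euclidsLemma; prime⇒nonTrivial)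
import Data.Nat.Tactic.RingSolver as ℕSolver
open import Data.Integer as ℤ using (ℤ; +_; 0ℤ; 1ℤ)
import Data.Integer.Properties as ℤP
import Data.Integer.Divisibility as ℤD
import Data.Integer.Divisibility.Signed as ℤS
import Data.Integer.Tactic.RingSolver as ℤSolver
open import Data.Rational as ℚ using (ℚ; toℚᵘ)
import Data.Rational.Properties as ℚP
open import Data.Rational.Unnormalised as ℚᵘ using (ℚᵘ; mkℚᵘ; _≃_; *≡*)
import Data.Rational.Unnormalised.Properties as ℚᵘP
open import Data.Product using (_,_; Σ; _×_; proj₁; proj₂)
open import Data.Sum using (_⊎_; inj₁; inj₂)
open import Data.Empty using (⊥-elim)
open import Relation.Nullary using (¬_; yes; no)
import Relation.Nullary.Decidable as Dec
open import Relation.Binary.PropositionalEquality as P using (_≡_; _≢_)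
import Relation.Binary.Reasoning.Setoid as SetoidReasoning

module FiniteSums (R : CommutativeRing 0ℓ 0ℓ) where
  open CommutativeRing R
  open Trunc 0# 1# _+_ _*_ using (sumTo)
  open SetoidReasoning setoid
  open CommSemigroupProps +-commutativeSemigroup using (interchange)

  Σ-cong : ∀ n {h k : ℕ → Carrier} → (∀ i → i < n → h i ≈ k i) → sumTo n h ≈ sumTo n k
  Σ-cong zero eq = refl
  Σ-cong (suc n) eq = +-cong (Σ-cong n (λ i i<n → eq i (ℕP.m<n⇒m<1+n i<n))) (eq n ℕP.≤-refl)

  Σ-cong′ : ∀ n {h k : ℕ → Carrier} → (∀ i → h i ≈ k i) → sumTo n h ≈ sumTo n k
  Σ-cong′ n eq = Σ-cong n (λ i _ → eq i)

  Σ-≡ : ∀ n {h k : ℕ → Carrier} → (∀ i → i < n → h i ≡ k i) → sumTo n h ≡ sumTo n k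
  Σ-≡ zero eq = P.refl
  Σ-≡ (suc n) eq = P.cong₂ _+_ (Σ-≡ n (λ i i<n → eq i (ℕP.m<n⇒m<1+n i<n))) (eq n ℕP.≤-refl)

  Σ-+ : ∀ n (h k : ℕ → Carrier) → sumTo n (λ i → h i + k i) ≈ sumTo n h + sumTo n k
  Σ-+ zero h k = sym (+-identityˡ 0#)
  Σ-+ (suc n) h k = trans (+-congʳ (Σ-+ n h k)) (interchange _ _ _ _)

  Σ-0 : ∀ n → sumTo n (λ _ → 0#) ≈ 0#
  Σ-0 zero = refl
  Σ-0 (suc n) = trans (+-identityʳ _) (Σ-0 n)

  Σ-vanish : ∀ n {h : ℕ → Carrier} → (∀ i → i < n → h i ≈ 0#) → sumTo n h ≈ 0#
  Σ-vanish n z = trans (Σ-cong n z) (Σ-0 n)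

  Σ-*ˡ : ∀ n c (h : ℕ → Carrier) → c * sumTo n h ≈ sumTo n (λ i → c * h i)
  Σ-*ˡ zero c h = zeroʳ c
  Σ-*ˡ (suc n) c h = trans (distribˡ c _ _) (+-congʳ (Σ-*ˡ n c h))

  Σ-*ʳ : ∀ n c (h : ℕ → Carrier) → sumTo n h * c ≈ sumTo n (λ i → h i * c)
  Σ-*ʳ zero c h = zeroˡ c
  Σ-*ʳ (suc n) c h = trans (distribʳ c _ _) (+-congʳ (Σ-*ʳ n c h))

  Σ-shift : ∀ n (h : ℕ → Carrier) → sumTo (suc n) h ≈ h 0 + sumTo n (λ i → h (suc i))
  Σ-shift zero h = trans (+-identityˡ _) (sym (+-identityʳ _))
  Σ-shift (suc n) h = trans (+-congʳ (Σ-shift n h)) (+-assoc _ _ _)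

  Σ-split : ∀ m n (h : ℕ → Carrier) → sumTo (m ℕ.+ n) h ≈ sumTo m h + sumTo n (λ i → h (m ℕ.+ i))
  Σ-split m zero h = trans (reflexive (P.cong (λ k → sumTo k h) (ℕP.+-identityʳ m))) (sym (+-identityʳ _))
  Σ-split m (suc n) h = begin
      sumTo (m ℕ.+ suc n) h
    ≡⟨ P.cong (λ k → sumTo k h) (ℕP.+-suc m n) ⟩
      sumTo (m ℕ.+ n) h + h (m ℕ.+ n)
    ≈⟨ +-congʳ (Σ-split m n h) ⟩
      (sumTo m h + sumTo n (λ i → h (m ℕ.+ i))) + h (m ℕ.+ n)
    ≈⟨ +-assoc _ _ _ ⟩
      sumTo m h + sumTo (suc n) (λ i → h (m ℕ.+ i))
    ∎

  Σ-rev : ∀ n (h : ℕ → Carrier) → sumTo (suc n) h ≈ sumTo (suc n) (λ i → h (n ∸ i))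
  Σ-rev zero h = refl
  Σ-rev (suc n) h = begin
      sumTo (suc n) h + h (suc n)
    ≈⟨ +-comm _ _ ⟩
      h (suc n) + sumTo (suc n) h
    ≈⟨ +-congˡ (Σ-rev n h) ⟩
      h (suc n) + sumTo (suc n) (λ i → h (n ∸ i))
    ≈⟨ sym (Σ-shift (suc n) (λ i → h (suc n ∸ i))) ⟩
      sumTo (suc (suc n)) (λ i → h (suc n ∸ i))
    ∎

  Σ-swap : ∀ m n (F : ℕ → ℕ → Carrier) →
    sumTo m (λ i → sumTo n (λ j → F i j)) ≈ sumTo n (λ j → sumTo m (λ i → F i j))
  Σ-swap zero n F = sym (Σ-0 n)
  Σ-swap (suc m) n F = begin
      sumTo m (λ i → sumTo n (λ j → F i j)) + sumTo n (λ j → F m j)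
    ≈⟨ +-congʳ (Σ-swap m n F) ⟩
      sumTo n (λ j → sumTo m (λ i → F i j)) + sumTo n (λ j → F m j)
    ≈⟨ sym (Σ-+ n _ _) ⟩
      sumTo n (λ j → sumTo (suc m) (λ i → F i j))
    ∎

  -- Reindexing a sum over triples j + k + l = n: the key step of
  -- associativity of Cauchy products.
  Σ-tri : ∀ n (G : ℕ → ℕ → ℕ → Carrier) →
    sumTo (suc n) (λ i → sumTo (suc i) (λ j → G j (i ∸ j) (n ∸ i)))
      ≈ sumTo (suc n) (λ j → sumTo (suc (n ∸ j)) (λ k → G j k (n ∸ j ∸ k)))
  Σ-tri zero G = refl
  Σ-tri (suc n) G = begin
      sumTo (suc (suc n)) (λ i → sumTo (suc i) (λ j → G j (i ∸ j) (suc n ∸ i)))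
    ≈⟨ Σ-cong′ (suc (suc n)) (λ i → Σ-shift i _) ⟩
      sumTo (suc (suc n)) (λ i → G 0 i (suc n ∸ i) + sumTo i (λ j → G (suc j) (i ∸ suc j) (suc n ∸ i)))
    ≈⟨ Σ-+ (suc (suc n)) _ _ ⟩
      sumTo (suc (suc n)) (λ i → G 0 i (suc n ∸ i)) + sumTo (suc (suc n)) (λ i → sumTo i (λ j → G (suc j) (i ∸ suc j) (suc n ∸ i)))
    ≈⟨ +-congˡ (Σ-shift (suc n) _) ⟩
      sumTo (suc (suc n)) (λ i → G 0 i (suc n ∸ i)) + (0# + sumTo (suc n) (λ i → sumTo (suc i) (λ j → G (suc j) (i ∸ j) (n ∸ i))))
    ≈⟨ +-congˡ (+-identityˡ _) ⟩
      sumTo (suc (suc n)) (λ i → G 0 i (suc n ∸ i)) + sumTo (suc n) (λ i → sumTo (suc i) (λ j → G (suc j) (i ∸ j) (n ∸ i)))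
    ≈⟨ +-congˡ (Σ-tri n (λ j → G (suc j))) ⟩
      sumTo (suc (suc n)) (λ k → G 0 k (suc n ∸ k)) + sumTo (suc n) (λ j → sumTo (suc (n ∸ j)) (λ k → G (suc j) k (n ∸ j ∸ k)))
    ≈⟨ sym (Σ-shift (suc n) _) ⟩
      sumTo (suc (suc n)) (λ j → sumTo (suc (suc n ∸ j)) (λ k → G j k (suc n ∸ j ∸ k)))
    ∎

  Σ-square-triangle : ∀ M (K : ℕ → ℕ → Carrier) → (∀ a b → suc M ≤ a ℕ.+ b → K a b ≈ 0#) →
    sumTo (suc M) (λ a → sumTo (suc M) (λ b → K a b))
      ≈ sumTo (suc M) (λ n → sumTo (suc n) (λ a → K a (n ∸ a)))
  Σ-square-triangle M K z = begin
      sumTo (suc M) (λ a → sumTo (suc M) (λ b → K a b))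
    ≈⟨ Σ-cong (suc M) (λ a a<sM → cut a (ℕP.≤-pred a<sM)) ⟩
      sumTo (suc M) (λ j → sumTo (suc (M ∸ j)) (λ k → K j k))
    ≈⟨ sym (Σ-tri M (λ j k l → K j k)) ⟩
      sumTo (suc M) (λ n → sumTo (suc n) (λ a → K a (n ∸ a)))
    ∎
    where
      cut : ∀ a → a ≤ M → sumTo (suc M) (λ b → K a b) ≈ sumTo (suc (M ∸ a)) (λ b → K a b)
      cut a a≤M = begin
          sumTo (suc M) (λ b → K a b)
        ≡⟨ P.cong (λ n → sumTo n (λ b → K a b)) (P.cong suc (P.sym (ℕP.m∸n+n≡m a≤M))) ⟩
          sumTo (suc (M ∸ a) ℕ.+ a) (λ b → K a b)
        ≈⟨ Σ-split (suc (M ∸ a)) a _ ⟩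
          sumTo (suc (M ∸ a)) (λ b → K a b) + sumTo a (λ i → K a (suc (M ∸ a) ℕ.+ i))
        ≈⟨ +-congˡ (Σ-vanish a (λ i _ → z a _ (large i))) ⟩
          sumTo (suc (M ∸ a)) (λ b → K a b) + 0#
        ≈⟨ +-identityʳ _ ⟩
          sumTo (suc (M ∸ a)) (λ b → K a b)
        ∎
        where
          large : ∀ i → suc M ≤ a ℕ.+ (suc (M ∸ a) ℕ.+ i)
          large i = ℕP.≤-trans (ℕP.≤-reflexive (P.cong suc (P.sym (ℕP.m+[n∸m]≡n a≤M))))
                      (ℕP.≤-trans (ℕP.≤-reflexive (P.sym (ℕP.+-suc a (M ∸ a)))) (ℕP.+-monoʳ-≤ a (ℕP.m≤m+n (suc (M ∸ a)) i)))

  Σ-single : ∀ n k (h : ℕ → Carrier) → (∀ i → i < n → i ≢ k → h i ≈ 0#) → k < n → sumTo n h ≈ h k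
  Σ-single (suc n) k h z k<sn with ℕP.m≤n⇒m<n∨m≡n (ℕP.≤-pred k<sn)
  ... | inj₁ k<n = trans (+-cong (Σ-single n k h (λ i i<n → z i (ℕP.m<n⇒m<1+n i<n)) k<n)
                                 (z n ℕP.≤-refl (λ e → ℕP.<-irrefl (P.sym e) k<n)))
                         (+-identityʳ _)
  ... | inj₂ P.refl = trans (+-congʳ (Σ-vanish n (λ i i<n → z i (ℕP.m<n⇒m<1+n i<n) (λ e → ℕP.<-irrefl e i<n))))
                            (+-identityˡ _)

-- Binomial coefficients, defined by Pascal's rule so that the binomial
-- theorem below is a direct induction.
module Binomial where
  open import Data.Nat using (_+_; _*_)

  bin : ℕ → ℕ → ℕ
  bin n zero = 1
  bin zero (suc k) = 0
  bin (suc n) (suc k) = bin n k + bin n (suc k)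

  bin-> : ∀ n k → n < k → bin n k ≡ 0
  bin-> zero (suc k) _ = P.refl
  bin-> (suc n) (suc k) (s≤s n<k) = P.cong₂ _+_ (bin-> n k n<k) (bin-> n (suc k) (ℕP.m<n⇒m<1+n n<k))

  bin-n-n : ∀ n → bin n n ≡ 1
  bin-n-n zero = P.refl
  bin-n-n (suc n) = P.cong₂ _+_ (bin-n-n n) (bin-> n (suc n) ℕP.≤-refl)

  bin-sn-n : ∀ n → bin (suc n) n ≡ suc n
  bin-sn-n zero = P.refl
  bin-sn-n (suc n) = P.trans (P.cong₂ _+_ (bin-sn-n n) (bin-n-n (suc n))) (ℕP.+-comm (suc n) 1)

  fact-bin : ∀ a b → bin (a + b) a * (a ! * b !) ≡ (a + b) !
  fact-bin zero b = P.trans (ℕP.*-identityˡ _) (ℕP.*-identityˡ _)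
  fact-bin (suc a) zero = begin
      bin (suc (a + 0)) (suc a) * (suc a ! * 1)
    ≡⟨ P.cong (λ n → bin (suc n) (suc a) * (suc a ! * 1)) (ℕP.+-identityʳ a) ⟩
      bin (suc a) (suc a) * (suc a ! * 1)
    ≡⟨ P.cong (_* (suc a ! * 1)) (bin-n-n (suc a)) ⟩
      1 * (suc a ! * 1)
    ≡⟨ P.trans (ℕP.*-identityˡ _) (ℕP.*-identityʳ _) ⟩
      suc a !
    ≡⟨ P.cong (λ n → suc n !) (P.sym (ℕP.+-identityʳ a)) ⟩
      suc (a + 0) !
    ∎
    where open P.≡-Reasoning
  fact-bin (suc a) (suc b) =
    pascal-step (bin (a + suc b) a) (bin (a + suc b) (suc a)) a b ((a + suc b) !) (b !) (fact-bin a (suc b)) shifted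
    where
      shifted : bin (a + suc b) (suc a) * ((suc a * a !) * b !) ≡ (a + suc b) !
      shifted = P.subst (λ n → bin n (suc a) * ((suc a * a !) * b !) ≡ n !) (P.sym (ℕP.+-suc a b)) (fact-bin (suc a) b)
      -- the Pascal summands satisfy the claim for (a, b+1) and (a+1, b);
      -- weighted by a+1 and b+1 they add up to the claim for (a+1, b+1)
      pascal-step : ∀ X Y a b A B → X * (a ! * (suc b * B)) ≡ A → Y * ((suc a * a !) * B) ≡ A →
                    (X + Y) * ((suc a * a !) * (suc b * B)) ≡ (suc a + suc b) * A
      pascal-step X Y a b A B e1 e2 =
        P.trans (distribute X Y (a !) B a b)
          (P.trans (P.cong₂ (λ u v → suc a * u + suc b * v) e1 e2) (P.sym (ℕP.*-distribʳ-+ A (suc a) (suc b))))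
        where distribute : ∀ X Y F B a b → (X + Y) * ((suc a * F) * (suc b * B))
                                            ≡ suc a * (X * (F * (suc b * B))) + suc b * (Y * ((suc a * F) * B))
              distribute = ℕSolver.solve-∀

module RingArithmetic (S : CommutativeRing 0ℓ 0ℓ) where
  open CommutativeRing S
  open Trunc 0# 1# _+_ _*_ using (sumTo)
  open FiniteSums S
  open Binomial
  open SetoidReasoning setoid

  pw : Carrier → ℕ → Carrier
  pw x zero = 1#
  pw x (suc n) = pw x n * x

  fromN : ℕ → Carrier
  fromN zero = 0#
  fromN (suc n) = fromN n + 1#

  fromN-+ : ∀ m n → fromN (m ℕ.+ n) ≈ fromN m + fromN n
  fromN-+ zero n = sym (+-identityˡ _)
  fromN-+ (suc m) n = trans (+-congʳ (fromN-+ m n)) (trans (+-assoc _ _ _)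
    (trans (+-congˡ (+-comm _ _)) (sym (+-assoc _ _ _))))

  fromN-* : ∀ m n → fromN (m ℕ.* n) ≈ fromN m * fromN n
  fromN-* zero n = sym (zeroˡ _)
  fromN-* (suc m) n = begin
      fromN (n ℕ.+ m ℕ.* n)
    ≈⟨ fromN-+ n (m ℕ.* n) ⟩
      fromN n + fromN (m ℕ.* n)
    ≈⟨ +-cong (sym (*-identityˡ _)) (fromN-* m n) ⟩
      1# * fromN n + fromN m * fromN n
    ≈⟨ sym (distribʳ _ _ _) ⟩
      (1# + fromN m) * fromN n
    ≈⟨ *-congʳ (+-comm _ _) ⟩
      (fromN m + 1#) * fromN n
    ∎

  fromN-1 : fromN 1 ≈ 1#
  fromN-1 = +-identityˡ 1#

  Σ-ones : ∀ n → sumTo n (λ _ → 1#) ≈ fromN n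
  Σ-ones zero = refl
  Σ-ones (suc n) = +-congʳ (Σ-ones n)

  pw-cong : ∀ {x y} n → x ≈ y → pw x n ≈ pw y n
  pw-cong zero e = refl
  pw-cong (suc n) e = *-cong (pw-cong n e) e

  pw-+ : ∀ x m n → pw x (m ℕ.+ n) ≈ pw x m * pw x n
  pw-+ x m zero = trans (reflexive (P.cong (pw x) (ℕP.+-identityʳ m))) (sym (*-identityʳ _))
  pw-+ x m (suc n) = trans (reflexive (P.cong (pw x) (ℕP.+-suc m n)))
    (trans (*-congʳ (pw-+ x m n)) (*-assoc _ _ _))

  pw-* : ∀ x y n → pw (x * y) n ≈ pw x n * pw y n
  pw-* x y zero = sym (*-identityʳ _)
  pw-* x y (suc n) = trans (*-congʳ (pw-* x y n)) (interchange _ _ _ _)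
    where open CommSemigroupProps *-commutativeSemigroup using (interchange)

  pw-zero : ∀ n → 1 ≤ n → pw 0# n ≈ 0#
  pw-zero (suc n) _ = zeroʳ (pw 0# n)

  pw-one : ∀ n → pw 1# n ≈ 1#
  pw-one zero = refl
  pw-one (suc n) = trans (*-identityʳ _) (pw-one n)

  binSum : Carrier → Carrier → ℕ → Carrier
  binSum x y n = sumTo (suc n) λ k → fromN (bin n k) * (pw x k * pw y (n ∸ k))

  binomial : ∀ x y n → pw (x + y) n ≈ binSum x y n
  binomial x y zero = sym (trans (+-identityˡ _) (trans (*-cong fromN-1 (*-identityˡ 1#)) (*-identityˡ 1#)))
  binomial x y (suc n) = begin
      pw (x + y) n * (x + y)
    ≈⟨ *-congʳ (binomial x y n) ⟩
      binSum x y n * (x + y)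
    ≈⟨ distribˡ _ _ _ ⟩
      binSum x y n * x + binSum x y n * y
    ≈⟨ +-cong (trans (Σ-*ʳ (suc n) _ _) (Σ-cong′ (suc n) (λ k → timesX k)))
              (trans (Σ-*ʳ (suc n) _ _) (Σ-cong (suc n) (λ k k<n → timesY k (ℕP.≤-pred k<n)))) ⟩
      P1 + P2
    ≈⟨ +-congˡ (Σ-shift n _) ⟩
      P1 + (fromN 1 * (1# * pw y (suc n)) + P2′)
    ≈⟨ trans (+-comm _ _) (+-assoc _ _ _) ⟩
      fromN 1 * (1# * pw y (suc n)) + (P2′ + P1)
    ≈⟨ +-congˡ (+-congʳ (sym (trans (+-congˡ topVanishes) (+-identityʳ _)))) ⟩
      fromN 1 * (1# * pw y (suc n)) + (P3 + P1)
    ≈⟨ +-congˡ (trans (+-comm _ _) (sym (Σ-+ (suc n) _ _))) ⟩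
      fromN 1 * (1# * pw y (suc n)) + sumTo (suc n) (λ k → fromN (bin n k) * (pw x (suc k) * pw y (n ∸ k))
                                                        + fromN (bin n (suc k)) * (pw x (suc k) * pw y (n ∸ k)))
    ≈⟨ +-congˡ (Σ-cong′ (suc n) (λ k → trans (sym (distribʳ _ _ _)) (*-congʳ (sym (fromN-+ (bin n k) (bin n (suc k))))))) ⟩
      fromN 1 * (1# * pw y (suc n)) + sumTo (suc n) (λ k → fromN (bin (suc n) (suc k)) * (pw x (suc k) * pw y (suc n ∸ suc k)))
    ≈⟨ sym (Σ-shift (suc n) _) ⟩
      binSum x y (suc n)
    ∎
    where
      P1 : Carrier
      P1 = sumTo (suc n) (λ k → fromN (bin n k) * (pw x (suc k) * pw y (n ∸ k)))
      P2 : Carrier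
      P2 = sumTo (suc n) (λ k → fromN (bin n k) * (pw x k * pw y (suc n ∸ k)))
      P2′ : Carrier
      P2′ = sumTo n (λ k → fromN (bin n (suc k)) * (pw x (suc k) * pw y (n ∸ k)))
      P3 : Carrier
      P3 = sumTo (suc n) (λ k → fromN (bin n (suc k)) * (pw x (suc k) * pw y (n ∸ k)))
      timesX : ∀ k → fromN (bin n k) * (pw x k * pw y (n ∸ k)) * x ≈ fromN (bin n k) * (pw x (suc k) * pw y (n ∸ k))
      timesX k = trans (*-assoc _ _ _) (*-congˡ (trans (*-assoc _ _ _) (trans (*-congˡ (*-comm _ _))
                   (sym (*-assoc _ _ _)))))
      timesY : ∀ k → k ≤ n → fromN (bin n k) * (pw x k * pw y (n ∸ k)) * y ≈ fromN (bin n k) * (pw x k * pw y (suc n ∸ k))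
      timesY k k≤n = trans (*-assoc _ _ _) (*-congˡ (trans (*-assoc _ _ _) (*-congˡ
                       (reflexive (P.cong (pw y) (P.sym (ℕP.+-∸-assoc 1 k≤n)))))))
      topVanishes : fromN (bin n (suc n)) * (pw x (suc n) * pw y (n ∸ n)) ≈ 0#
      topVanishes = trans (*-congʳ (reflexive (P.cong fromN (bin-> n (suc n) ℕP.≤-refl)))) (zeroˡ _)

-- Bivariate polynomials are series of series, which is how
-- the ring axioms for Defs' _⊗_ are obtained below.
module PowerSeries (R : CommutativeRing 0ℓ 0ℓ) where
  open CommutativeRing R
  open Trunc 0# 1# _+_ _*_ using (sumTo)
  open FiniteSums R
  open SetoidReasoning setoid

  Series : Set
  Series = ℕ → Carrier

  infix 4 _≋_
  _≋_ : Series → Series → Set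
  f ≋ g = ∀ n → f n ≈ g n

  _⊞_ : Series → Series → Series
  (f ⊞ g) n = f n + g n

  ⊟_ : Series → Series
  (⊟ f) n = - f n

  𝟘 : Series
  𝟘 _ = 0#

  𝟙 : Series
  𝟙 zero = 1#
  𝟙 (suc _) = 0#

  _⊠_ : Series → Series → Series
  (f ⊠ g) n = sumTo (suc n) λ i → f i * g (n ∸ i)

  ⊠-comm : ∀ f g → (f ⊠ g) ≋ (g ⊠ f)
  ⊠-comm f g n = begin
      sumTo (suc n) (λ i → f i * g (n ∸ i))
    ≈⟨ Σ-rev n _ ⟩
      sumTo (suc n) (λ i → f (n ∸ i) * g (n ∸ (n ∸ i)))
    ≈⟨ Σ-cong (suc n) (λ i i<sn → trans (*-comm _ _)
          (*-congʳ (reflexive (P.cong g (ℕP.m∸[m∸n]≡n (ℕP.≤-pred i<sn)))))) ⟩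
      sumTo (suc n) (λ i → g i * f (n ∸ i))
    ∎

  ⊠-assoc : ∀ f g h → ((f ⊠ g) ⊠ h) ≋ (f ⊠ (g ⊠ h))
  ⊠-assoc f g h n = begin
      sumTo (suc n) (λ i → sumTo (suc i) (λ j → f j * g (i ∸ j)) * h (n ∸ i))
    ≈⟨ Σ-cong′ (suc n) (λ i → Σ-*ʳ (suc i) _ _) ⟩
      sumTo (suc n) (λ i → sumTo (suc i) (λ j → (f j * g (i ∸ j)) * h (n ∸ i)))
    ≈⟨ Σ-cong′ (suc n) (λ i → Σ-cong′ (suc i) (λ j → *-assoc _ _ _)) ⟩
      sumTo (suc n) (λ i → sumTo (suc i) (λ j → f j * (g (i ∸ j) * h (n ∸ i))))
    ≈⟨ Σ-tri n (λ j k l → f j * (g k * h l)) ⟩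
      sumTo (suc n) (λ j → sumTo (suc (n ∸ j)) (λ k → f j * (g k * h (n ∸ j ∸ k))))
    ≈⟨ Σ-cong′ (suc n) (λ j → sym (Σ-*ˡ (suc (n ∸ j)) _ _)) ⟩
      sumTo (suc n) (λ j → f j * (g ⊠ h) (n ∸ j))
    ∎

  ⊠-identityˡ : ∀ f → (𝟙 ⊠ f) ≋ f
  ⊠-identityˡ f n = begin
      sumTo (suc n) (λ i → 𝟙 i * f (n ∸ i))
    ≈⟨ Σ-shift n _ ⟩
      1# * f n + sumTo n (λ i → 0# * f (n ∸ suc i))
    ≈⟨ +-cong (*-identityˡ _) (Σ-vanish n (λ i _ → zeroˡ _)) ⟩
      f n + 0#
    ≈⟨ +-identityʳ _ ⟩
      f n
    ∎

  ⊠-distribˡ : ∀ f g h → (f ⊠ (g ⊞ h)) ≋ ((f ⊠ g) ⊞ (f ⊠ h))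
  ⊠-distribˡ f g h n = trans (Σ-cong′ (suc n) (λ i → distribˡ _ _ _)) (Σ-+ (suc n) _ _)

  ⊠-cong : ∀ {f f′ g g′} → f ≋ f′ → g ≋ g′ → (f ⊠ g) ≋ (f′ ⊠ g′)
  ⊠-cong ff gg n = Σ-cong′ (suc n) (λ i → *-cong (ff i) (gg (n ∸ i)))

  isSeriesRing : IsCommutativeRing _≋_ _⊞_ _⊠_ ⊟_ 𝟘 𝟙
  isSeriesRing = record
    { isRing = record
      { +-isAbelianGroup = record
        { isGroup = record
          { isMonoid = record
            { isSemigroup = record
              { isMagma = record
                { isEquivalence = record
                  { refl = λ n → refl ; sym = λ e n → sym (e n) ; trans = λ e e′ n → trans (e n) (e′ n) }
                ; ∙-cong = λ e e′ n → +-cong (e n) (e′ n) }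
              ; assoc = λ f g h n → +-assoc (f n) (g n) (h n) }
            ; identity = (λ f n → +-identityˡ (f n)) , (λ f n → +-identityʳ (f n)) }
          ; inverse = (λ f n → -‿inverseˡ (f n)) , (λ f n → -‿inverseʳ (f n))
          ; ⁻¹-cong = λ e n → -‿cong (e n) }
        ; comm = λ f g n → +-comm (f n) (g n) }
      ; *-cong = ⊠-cong
      ; *-assoc = ⊠-assoc
      ; *-identity = ⊠-identityˡ , (λ f n → trans (⊠-comm f 𝟙 n) (⊠-identityˡ f n))
      ; distrib = ⊠-distribˡ , (λ f g h n → trans (⊠-comm (g ⊞ h) f n)
                   (trans (⊠-distribˡ f g h n) (+-cong (⊠-comm f g n) (⊠-comm f h n)))) }
    ; *-comm = ⊠-comm }

  seriesRing : CommutativeRing 0ℓ 0ℓ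
  seriesRing = record { isCommutativeRing = isSeriesRing }

-- The coefficient array of f ⊗ g is
-- literally the Cauchy product of f and g viewed as series (in y₀) of series
-- (in y₁), so _⊗_ inherits the ring laws from PowerSeries; comparing only the
-- coefficients (a,b) with a,b < K then gives R[y₀,y₁]/⟨y₀^K,y₁^K⟩.
module Bivariate (R : CommutativeRing 0ℓ 0ℓ) where
  open CommutativeRing R
  open Trunc 0# 1# _+_ _*_ public
  open FiniteSums R
  private
    module Inner = PowerSeries R
    module Outer = PowerSeries Inner.seriesRing
    module InnerRing = CommutativeRing Inner.seriesRing
    module InnerSums = Trunc InnerRing.0# InnerRing.1# InnerRing._+_ InnerRing._*_

  sumP-at : ∀ n (F : ℕ → Pol) a b → sumP n F a b ≡ sumTo n (λ i → F i a b)
  sumP-at zero F a b = P.refl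
  sumP-at (suc n) F a b = P.cong (_+ F n a b) (sumP-at n F a b)

  sumTo-at : ∀ n (H : ℕ → ℕ → Carrier) b → InnerSums.sumTo n H b ≡ sumTo n (λ i → H i b)
  sumTo-at zero H b = P.refl
  sumTo-at (suc n) H b = P.cong (_+ H n b) (sumTo-at n H b)

  infix 4 _≐_
  _≐_ : Pol → Pol → Set
  f ≐ g = ∀ a b → f a b ≈ g a b

  negT : Pol → Pol
  negT f a b = - f a b

  ⊗-as-series : ∀ f g → (f ⊗ g) ≐ Outer._⊠_ f g
  ⊗-as-series f g a b = reflexive (P.sym (sumTo-at (suc a) (λ i → Inner._⊠_ (f i) (g (a ∸ i))) b))

  oneP-as-series : ∀ a b → oneP a b ≈ Outer.𝟙 a b
  oneP-as-series zero zero = refl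
  oneP-as-series zero (suc b) = refl
  oneP-as-series (suc a) b = refl

  ⊗-comm : ∀ f g → (f ⊗ g) ≐ (g ⊗ f)
  ⊗-comm f g a b = trans (⊗-as-series f g a b) (trans (Outer.⊠-comm f g a b) (sym (⊗-as-series g f a b)))

  ⊗-assoc : ∀ f g h → ((f ⊗ g) ⊗ h) ≐ (f ⊗ (g ⊗ h))
  ⊗-assoc f g h a b =
    trans (⊗-as-series (f ⊗ g) h a b)
    (trans (Outer.⊠-cong {f ⊗ g} {Outer._⊠_ f g} {h} {h} (⊗-as-series f g) (λ _ _ → refl) a b)
    (trans (Outer.⊠-assoc f g h a b)
    (trans (Outer.⊠-cong {f} {f} {Outer._⊠_ g h} {g ⊗ h} (λ _ _ → refl) (λ a b → sym (⊗-as-series g h a b)) a b)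
           (sym (⊗-as-series f (g ⊗ h) a b)))))

  ⊗-identityˡ : ∀ f → (oneP ⊗ f) ≐ f
  ⊗-identityˡ f a b =
    trans (⊗-as-series oneP f a b)
    (trans (Outer.⊠-cong {oneP} {Outer.𝟙} {f} {f} oneP-as-series (λ _ _ → refl) a b)
           (Outer.⊠-identityˡ f a b))

  ⊗-distribˡ : ∀ f g h → (f ⊗ (g ⊕ h)) ≐ ((f ⊗ g) ⊕ (f ⊗ h))
  ⊗-distribˡ f g h a b = trans (⊗-as-series f (g ⊕ h) a b) (trans (Outer.⊠-distribˡ f g h a b)
    (+-cong (sym (⊗-as-series f g a b)) (sym (⊗-as-series f h a b))))

  module Truncation (K : ℕ) where
    infix 4 _≈T_
    _≈T_ : Pol → Pol → Set
    f ≈T g = ∀ a b → a < K → b < K → f a b ≈ g a b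

    pt : ∀ {f g} → f ≐ g → f ≈T g
    pt e a b _ _ = e a b

    -- coefficient (a,b) of a product only involves coefficients below (a,b)
    ⊗-congT : ∀ {f f′ g g′} → f ≈T f′ → g ≈T g′ → (f ⊗ g) ≈T (f′ ⊗ g′)
    ⊗-congT ff gg a b a<K b<K = Σ-cong (suc a) (λ i i<a → Σ-cong (suc b) (λ j j<b →
      *-cong (ff i j (ℕP.≤-<-trans (ℕP.≤-pred i<a) a<K) (ℕP.≤-<-trans (ℕP.≤-pred j<b) b<K))
             (gg (a ∸ i) (b ∸ j) (ℕP.≤-<-trans (ℕP.m∸n≤m a i) a<K) (ℕP.≤-<-trans (ℕP.m∸n≤m b j) b<K))))

    isTruncatedRing : IsCommutativeRing _≈T_ _⊕_ _⊗_ negT zeroP oneP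
    isTruncatedRing = record
      { isRing = record
        { +-isAbelianGroup = record
          { isGroup = record
            { isMonoid = record
              { isSemigroup = record
                { isMagma = record
                  { isEquivalence = record
                    { refl = λ a b _ _ → refl ; sym = λ e a b x y → sym (e a b x y)
                    ; trans = λ e e′ a b x y → trans (e a b x y) (e′ a b x y) }
                  ; ∙-cong = λ e e′ a b x y → +-cong (e a b x y) (e′ a b x y) }
                ; assoc = λ f g h a b _ _ → +-assoc (f a b) (g a b) (h a b) }
              ; identity = (λ f a b _ _ → +-identityˡ (f a b)) , (λ f a b _ _ → +-identityʳ (f a b)) }
            ; inverse = (λ f a b _ _ → -‿inverseˡ (f a b)) , (λ f a b _ _ → -‿inverseʳ (f a b))
            ; ⁻¹-cong = λ e a b x y → -‿cong (e a b x y) }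
          ; comm = λ f g a b _ _ → +-comm (f a b) (g a b) }
        ; *-cong = ⊗-congT
        ; *-assoc = λ f g h → pt (⊗-assoc f g h)
        ; *-identity = (λ f → pt (⊗-identityˡ f)) , (λ f → pt (λ a b → trans (⊗-comm f oneP a b) (⊗-identityˡ f a b)))
        ; distrib = (λ f g h → pt (⊗-distribˡ f g h)) , (λ f g h → pt (λ a b → trans (⊗-comm (g ⊕ h) f a b)
                     (trans (⊗-distribˡ f g h a b) (+-cong (⊗-comm f g a b) (⊗-comm f h a b))))) }
      ; *-comm = λ f g → pt (⊗-comm f g) }

    truncatedRing : CommutativeRing 0ℓ 0ℓ
    truncatedRing = record { isCommutativeRing = isTruncatedRing }

    private
      module TA = RingArithmetic truncatedRing
      module TS = Trunc zeroP oneP _⊕_ _⊗_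

    pw≡^P : ∀ g n → TA.pw g n ≡ g ^P n
    pw≡^P g zero = P.refl
    pw≡^P g (suc n) = P.cong (_⊗ g) (pw≡^P g n)

    pw≈^P : ∀ g n → TA.pw g n ≈T (g ^P n)
    pw≈^P g n a b _ _ = reflexive (P.cong (λ f → f a b) (pw≡^P g n))

    sumP≡sumTo : ∀ n F → sumP n F ≡ TS.sumTo n F
    sumP≡sumTo zero F = P.refl
    sumP≡sumTo (suc n) F = P.cong (_⊕ F n) (sumP≡sumTo n F)

module PrimeFacts {p : ℕ} (pp : Prime p) where
  open import Data.Nat using (_+_; _*_)
  open ℕD using (_∣_; divides; ∣⇒≤)
  open Binomial

  1<p : 1 < p
  1<p = ℕ.nonTrivial⇒n>1 p {{prime⇒nonTrivial pp}}

  ¬p∣small : ∀ m → 0 < m → m < p → ¬ p ∣ m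
  ¬p∣small (suc m) _ m<p d = ℕP.<⇒≱ m<p (∣⇒≤ d)

  ¬p∣* : ∀ {m n} → ¬ p ∣ m → ¬ p ∣ n → ¬ p ∣ (m * n)
  ¬p∣* {m} {n} a b d with euclidsLemma m n pp d
  ... | inj₁ x = a x
  ... | inj₂ x = b x

  ¬p∣small! : ∀ m → m < p → ¬ p ∣ (m !)
  ¬p∣small! zero _ d = ℕP.<⇒≱ 1<p (∣⇒≤ d)
  ¬p∣small! (suc m) m<p = ¬p∣* (¬p∣small (suc m) (s≤s z≤n) m<p) (¬p∣small! m (ℕP.<-trans (ℕP.n<1+n m) m<p))

  p≢0 : 0 ≢ p
  p≢0 = ℕP.<⇒≢ (ℕP.<-trans ℕ.z<s 1<p)

  p∣p! : p ∣ p !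
  p∣p! = go p P.refl
    where go : ∀ q → q ≡ p → p ∣ q !
          go zero e = ⊥-elim (p≢0 e)
          go (suc q) P.refl = ℕD.m∣m*n (q !)

  p∣bin : ∀ k → 0 < k → k < p → p ∣ bin p k
  p∣bin k 0<k k<p with euclidsLemma (bin p k) (k ! * (p ∸ k) !) pp p∣product
    where
      p∣product : p ∣ bin p k * (k ! * (p ∸ k) !)
      p∣product = P.subst (p ∣_) (P.sym (P.subst (λ n → bin n k * (k ! * (p ∸ k) !) ≡ n !)
                                              (ℕP.m+[n∸m]≡n (ℕP.<⇒≤ k<p)) (fact-bin k (p ∸ k))))
                                p∣p!
  ... | inj₁ x = x
  ... | inj₂ x = ⊥-elim (¬p∣* (¬p∣small! k k<p) (¬p∣small! (p ∸ k) (ℕP.∸-monoʳ-< {p} {k} {0} 0<k (ℕP.<⇒≤ k<p))) x)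

  factorial-p+j : ∀ j → j < p → Σ ℕ λ m → ((p + j) ! ≡ p * m) × (¬ p ∣ m)
  factorial-p+j zero _ = go p P.refl
    where go : ∀ q → q ≡ p → Σ ℕ λ m → ((q + 0) ! ≡ p * m) × (¬ p ∣ m)
          go zero e = ⊥-elim (p≢0 e)
          go (suc q) P.refl = q ! , P.cong (λ n → suc n * n !) (ℕP.+-identityʳ q) , ¬p∣small! q ℕP.≤-refl
  factorial-p+j (suc j) sj<p with factorial-p+j j (ℕP.<-trans (ℕP.n<1+n j) sj<p)
  ... | m , e , nd = suc (p + j) * m , eq , ¬p∣* ¬p∣p+j+1 nd
    where
      eq : (p + suc j) ! ≡ p * (suc (p + j) * m)
      eq = begin
          (p + suc j) !
        ≡⟨ P.cong _! (ℕP.+-suc p j) ⟩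
          suc (p + j) * (p + j) !
        ≡⟨ P.cong (suc (p + j) *_) e ⟩
          suc (p + j) * (p * m)
        ≡⟨ CommSemigroupProps.x∙yz≈y∙xz ℕP.*-commutativeSemigroup (suc (p + j)) p m ⟩
          p * (suc (p + j) * m)
        ∎
        where open P.≡-Reasoning
      ¬p∣p+j+1 : ¬ p ∣ suc (p + j)
      ¬p∣p+j+1 d = ¬p∣small (suc j) ℕ.z<s sj<p (ℕD.∣m+n∣m⇒∣n (P.subst (p ∣_) (P.sym (ℕP.+-suc p j)) d) ℕD.∣-refl)

  odd-prime : p ≢ 2 → Σ ℕ λ r → p ≡ suc (2 * r)
  odd-prime p≢2 with p % 2 | m%n<n p 2 | m≡m%n+[m/n]*n p 2
  ... | 0 | _ | e = ⊥-elim (Prime.notComposite pp (composite {d = 2} 2<p (divides (p / 2) e)))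
    where 2<p : 2 < p
          2<p = ℕP.≤∧≢⇒< 1<p (λ x → p≢2 (P.sym x))
  ... | 1 | _ | e = p / 2 , P.trans e (P.cong suc (ℕP.*-comm (p / 2) 2))
  ... | suc (suc _) | s≤s (s≤s ()) | _

module IntegersModP (p : ℕ) where
  open import Data.Integer using (_+_; _*_; -_; _-_)
  open ℤD using (_∣_)

  private
    -- the differences whose divisibility by p the ring laws require
    diff-sym : ∀ a b → b - a ≡ - (a - b)
    diff-sym = ℤSolver.solve-∀
    diff-trans : ∀ a b c → a - c ≡ (a - b) + (b - c)
    diff-trans = ℤSolver.solve-∀
    diff-+ : ∀ a b c d → (a + b) - (c + d) ≡ (a - c) + (b - d)
    diff-+ = ℤSolver.solve-∀
    diff-* : ∀ a b c d → (a * b) - (c * d) ≡ a * (b - d) + (a - c) * d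
    diff-* = ℤSolver.solve-∀
    diff-neg : ∀ a b → (- a) - (- b) ≡ - (a - b)
    diff-neg = ℤSolver.solve-∀

    toS : ∀ a → (+ p) ∣ a → (+ p) ℤS.∣ a
    toS a = ℤS.∣ᵤ⇒∣ {+ p} {a}
    fromS : ∀ a → (+ p) ℤS.∣ a → (+ p) ∣ a
    fromS a = ℤS.∣⇒∣ᵤ {+ p} {a}

    dv-+ : ∀ a b → (+ p) ∣ a → (+ p) ∣ b → (+ p) ∣ (a + b)
    dv-+ a b x y = fromS (a + b) (ℤS.∣m∣n⇒∣m+n {+ p} {a} {b} (toS a x) (toS b y))
    dv-neg : ∀ a → (+ p) ∣ a → (+ p) ∣ (- a)
    dv-neg a x = fromS (- a) (ℤS.∣m⇒∣-m {+ p} {a} (toS a x))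
    dv-*ˡ : ∀ c a → (+ p) ∣ a → (+ p) ∣ (c * a)
    dv-*ˡ c a x = fromS (c * a) (ℤS.∣n⇒∣m*n {+ p} c {a} (toS a x))
    dv-*ʳ : ∀ c a → (+ p) ∣ a → (+ p) ∣ (a * c)
    dv-*ʳ c a x = fromS (a * c) (ℤS.∣m⇒∣m*n {+ p} {a} c (toS a x))

  dv-≡ : ∀ {a b} → a ≡ b → (+ p) ∣ a → (+ p) ∣ b
  dv-≡ P.refl x = x

  ≈-reflexive : ∀ {a b} → a ≡ b → a ≡[ p ] b
  ≈-reflexive {a} P.refl = dv-≡ (P.sym (ℤP.+-inverseʳ a)) (ℕD._∣0 p)

  ≈0⇒dv : ∀ {a} → a ≡[ p ] 0ℤ → (+ p) ∣ a
  ≈0⇒dv {a} x = dv-≡ (ℤP.+-identityʳ a) x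

  dv⇒≈0 : ∀ {a} → (+ p) ∣ a → a ≡[ p ] 0ℤ
  dv⇒≈0 {a} x = dv-≡ (P.sym (ℤP.+-identityʳ a)) x

  -- congruence wrapped in a record, so that its arguments stay inferable
  infix 4 _≋_
  record _≋_ (a b : ℤ) : Set where
    constructor mk
    field un : a ≡[ p ] b
  open _≋_ public

  private
    R : ∀ {a b} → a ≡ b → a ≋ b
    R e = mk (≈-reflexive e)

  isZmodRing : IsCommutativeRing _≋_ _+_ _*_ -_ 0ℤ 1ℤ
  isZmodRing = record
    { isRing = record
      { +-isAbelianGroup = record
        { isGroup = record
          { isMonoid = record
            { isSemigroup = record
              { isMagma = record
                { isEquivalence = record
                  { refl = R P.refl
                  ; sym = λ {a} {b} x → mk (dv-≡ (P.sym (diff-sym a b)) (dv-neg (a - b) (un x)))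
                  ; trans = λ {a} {b} {c} x y → mk (dv-≡ (P.sym (diff-trans a b c)) (dv-+ (a - b) (b - c) (un x) (un y))) }
                ; ∙-cong = λ {a} {c} {b} {d} x y → mk (dv-≡ (P.sym (diff-+ a b c d)) (dv-+ (a - c) (b - d) (un x) (un y))) }
              ; assoc = λ a b c → R (ℤP.+-assoc a b c) }
            ; identity = (λ a → R (ℤP.+-identityˡ a)) , (λ a → R (ℤP.+-identityʳ a)) }
          ; inverse = (λ a → R (ℤP.+-inverseˡ a)) , (λ a → R (ℤP.+-inverseʳ a))
          ; ⁻¹-cong = λ {a} {b} x → mk (dv-≡ (P.sym (diff-neg a b)) (dv-neg (a - b) (un x))) }
        ; comm = λ a b → R (ℤP.+-comm a b) }
      ; *-cong = λ {a} {c} {b} {d} x y → mk (dv-≡ (P.sym (diff-* a b c d))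
                   (dv-+ (a * (b - d)) ((a - c) * d) (dv-*ˡ a (b - d) (un y)) (dv-*ʳ d (a - c) (un x))))
      ; *-assoc = λ a b c → R (ℤP.*-assoc a b c)
      ; *-identity = (λ a → R (ℤP.*-identityˡ a)) , (λ a → R (ℤP.*-identityʳ a))
      ; distrib = (λ a b c → R (ℤP.*-distribˡ-+ a b c)) , (λ a b c → R (ℤP.*-distribʳ-+ a b c)) }
    ; *-comm = λ a b → R (ℤP.*-comm a b) }

  Zmod : CommutativeRing 0ℓ 0ℓ
  Zmod = record { isCommutativeRing = isZmodRing }

  module Prime-cancel (pp : Prime p) where
    euclidℤ : ∀ a b → (+ p) ∣ (a * b) → ((+ p) ∣ a) ⊎ ((+ p) ∣ b)
    euclidℤ a b x = euclidsLemma ℤ.∣ a ∣ ℤ.∣ b ∣ pp (P.subst (p ℕD.∣_) (ℤP.abs-* a b) x)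

    cancel : ∀ {a b d} → ¬ (+ p) ∣ d → (a * d) ≋ (b * d) → a ≋ b
    cancel {a} {b} {d} nd (mk x) with euclidℤ (a - b) d (dv-≡ (factor a b d) x)
      where factor : ∀ a b d → a * d - b * d ≡ (a - b) * d
            factor = ℤSolver.solve-∀
    ... | inj₁ y = mk y
    ... | inj₂ y = ⊥-elim (nd y)

module Frobenius (S : CommutativeRing 0ℓ 0ℓ) {p : ℕ} (pp : Prime p) where
  open CommutativeRing S
  open Trunc 0# 1# _+_ _*_ using (sumTo)
  open FiniteSums S
  open RingArithmetic S
  open Binomial
  open PrimeFacts pp
  open SetoidReasoning setoid

  module _ (char : fromN p ≈ 0#) where
    fromN-bin : ∀ k → 0 < k → k < p → fromN (bin p k) ≈ 0#
    fromN-bin k 0<k k<p with p∣bin k 0<k k<p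
    ... | ℕD.divides c e = trans (reflexive (P.cong fromN e)) (trans (fromN-* c p) (trans (*-congˡ char) (zeroʳ _)))

    frobenius : ∀ x y → pw (x + y) p ≈ pw x p + pw y p
    frobenius x y = trans (binomial x y p) (outerTerms p P.refl)
      where
        t : ℕ → Carrier
        t = λ k → fromN (bin p k) * (pw x k * pw y (p ∸ k))
        outerTerms : ∀ q → q ≡ p → sumTo (suc q) t ≈ pw x q + pw y p
        outerTerms zero e = ⊥-elim (p≢0 e)
        outerTerms (suc q) e = begin
            sumTo (suc q) t + t (suc q)
          ≈⟨ +-cong (Σ-shift q t) top ⟩
            (t 0 + sumTo q (λ k → t (suc k))) + pw x (suc q)
          ≈⟨ +-congʳ (+-congˡ (Σ-vanish q (λ k k<q →
               trans (*-congʳ (fromN-bin (suc k) ℕ.z<s (P.subst (suc k <_) e (s≤s k<q)))) (zeroˡ _)))) ⟩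
            (t 0 + 0#) + pw x (suc q)
          ≈⟨ trans (+-congʳ (trans (+-identityʳ _) bottom)) (+-comm _ _) ⟩
            pw x (suc q) + pw y p
          ∎
          where
            top : t (suc q) ≈ pw x (suc q)
            top = begin
                fromN (bin p (suc q)) * (pw x (suc q) * pw y (p ∸ suc q))
              ≡⟨ P.cong (λ r → fromN (bin r (suc q)) * (pw x (suc q) * pw y (r ∸ suc q))) (P.sym e) ⟩
                fromN (bin (suc q) (suc q)) * (pw x (suc q) * pw y (q ∸ q))
              ≡⟨ P.cong₂ (λ r s → fromN r * (pw x (suc q) * pw y s)) (bin-n-n (suc q)) (ℕP.n∸n≡0 q) ⟩
                fromN 1 * (pw x (suc q) * 1#)
              ≈⟨ trans (*-cong fromN-1 (*-identityʳ _)) (*-identityˡ _) ⟩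
                pw x (suc q)
              ∎
            bottom : t 0 ≈ pw y p
            bottom = trans (*-cong fromN-1 (*-identityˡ _)) (*-identityˡ _)

-- Power sums σ_P(k) = Σ_{i<P} i^k and alternating binomial sums
-- Δ(n,m) = Σ_{k≤n} (-1)^k C(n,k) k^m in a commutative ring.
module PowerSums (S : CommutativeRing 0ℓ 0ℓ) where
  open CommutativeRing S
  open Trunc 0# 1# _+_ _*_ using (sumTo)
  open FiniteSums S
  open RingArithmetic S
  open Binomial
  open SetoidReasoning setoid
  open NatCoeffSolver commutativeSemiring using (solve; _:=_; _:*_)
  open RingProps ring using (-1*x≈-x; -0#≈0#)

  Σ-telescope : ∀ P (f : ℕ → Carrier) → sumTo P (λ i → f (suc i) - f i) ≈ f P - f 0
  Σ-telescope zero f = sym (-‿inverseʳ (f 0))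
  Σ-telescope (suc P) f = trans (+-congʳ (Σ-telescope P f)) (collapse _ _ _)
    where
      collapse : ∀ a b c → (a - b) + (c - a) ≈ c - b
      collapse a b c = begin
          (a - b) + (c - a)     ≈⟨ +-comm _ _ ⟩
          (c - a) + (a - b)     ≈⟨ +-assoc _ _ _ ⟩
          c + (- a + (a - b))   ≈⟨ +-congˡ (sym (+-assoc _ _ _)) ⟩
          c + ((- a + a) - b)   ≈⟨ +-congˡ (+-congʳ (-‿inverseˡ a)) ⟩
          c + (0# - b)          ≈⟨ +-congˡ (+-identityˡ _) ⟩
          c - b                 ∎

  difference-of-powers : ∀ u n → pw (u + 1#) (suc n) - pw u (suc n) ≈ sumTo (suc n) (λ k → fromN (bin (suc n) k) * pw u k)
  difference-of-powers u n = begin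
      pw (u + 1#) (suc n) - pw u (suc n)
    ≈⟨ +-congʳ (binomial u 1# (suc n)) ⟩
      (sumTo (suc n) t + t (suc n)) - pw u (suc n)
    ≈⟨ +-congʳ (+-cong (Σ-cong′ (suc n) (λ k → *-congˡ (trans (*-congˡ (pw-one (suc n ∸ k))) (*-identityʳ _)))) top) ⟩
      (sumTo (suc n) (λ k → fromN (bin (suc n) k) * pw u k) + pw u (suc n)) - pw u (suc n)
    ≈⟨ trans (+-assoc _ _ _) (trans (+-congˡ (-‿inverseʳ _)) (+-identityʳ _)) ⟩
      sumTo (suc n) (λ k → fromN (bin (suc n) k) * pw u k)
    ∎
    where
      t : ℕ → Carrier
      t = λ k → fromN (bin (suc n) k) * (pw u k * pw 1# (suc n ∸ k))
      top : t (suc n) ≈ pw u (suc n)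
      top = trans (*-cong (reflexive (P.cong fromN (bin-n-n (suc n)))) (trans (*-congˡ (pw-one (n ∸ n))) (*-identityʳ _)))
              (trans (*-congʳ fromN-1) (*-identityˡ _))

  powerSum : ℕ → ℕ → Carrier
  powerSum P k = sumTo P (λ i → pw (fromN i) k)

  powerSum-recurrence : ∀ P n → sumTo (suc n) (λ k → fromN (bin (suc n) k) * powerSum P k) ≈ pw (fromN P) (suc n)
  powerSum-recurrence P n = begin
      sumTo (suc n) (λ k → fromN (bin (suc n) k) * powerSum P k)
    ≈⟨ Σ-cong′ (suc n) (λ k → Σ-*ˡ P _ _) ⟩
      sumTo (suc n) (λ k → sumTo P (λ i → fromN (bin (suc n) k) * pw (fromN i) k))
    ≈⟨ Σ-swap (suc n) P _ ⟩
      sumTo P (λ i → sumTo (suc n) (λ k → fromN (bin (suc n) k) * pw (fromN i) k))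
    ≈⟨ Σ-cong′ P (λ i → sym (difference-of-powers (fromN i) n)) ⟩
      sumTo P (λ i → pw (fromN (suc i)) (suc n) - pw (fromN i) (suc n))
    ≈⟨ Σ-telescope P (λ i → pw (fromN i) (suc n)) ⟩
      pw (fromN P) (suc n) - pw 0# (suc n)
    ≈⟨ +-congˡ (trans (-‿cong (zeroʳ _)) -0#≈0#) ⟩
      pw (fromN P) (suc n) + 0#
    ≈⟨ +-identityʳ _ ⟩
      pw (fromN P) (suc n)
    ∎

  sign : ℕ → Carrier
  sign k = pw (- 1#) k

  alternatingSum : ℕ → ℕ → Carrier
  alternatingSum n m = sumTo (suc n) (λ k → sign k * (fromN (bin n k) * pw (fromN k) m))

  shifted-term : ∀ n m k → sign (suc k) * (fromN (bin n k) * pw (fromN (suc k)) m)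
                         ≈ (- 1#) * sumTo (suc m) (λ l → fromN (bin m l) * (sign k * (fromN (bin n k) * pw (fromN k) l)))
  shifted-term n m k = begin
      (sign k * (- 1#)) * (fromN (bin n k) * pw (fromN k + 1#) m)
    ≈⟨ *-congˡ (*-congˡ (trans (binomial (fromN k) 1# m)
                          (Σ-cong′ (suc m) (λ l → *-congˡ (trans (*-congˡ (pw-one (m ∸ l))) (*-identityʳ _)))))) ⟩
      (sign k * (- 1#)) * (fromN (bin n k) * sumTo (suc m) (λ l → fromN (bin m l) * pw (fromN k) l))
    ≈⟨ solve 4 (λ s u b Σ → (s :* u) :* (b :* Σ) := u :* (s :* (b :* Σ))) refl (sign k) (- 1#) (fromN (bin n k)) _ ⟩
      (- 1#) * (sign k * (fromN (bin n k) * sumTo (suc m) (λ l → fromN (bin m l) * pw (fromN k) l)))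
    ≈⟨ *-congˡ (trans (*-congˡ (Σ-*ˡ (suc m) _ _)) (trans (Σ-*ˡ (suc m) _ _) (Σ-cong′ (suc m) (λ l → pull l)))) ⟩
      (- 1#) * sumTo (suc m) (λ l → fromN (bin m l) * (sign k * (fromN (bin n k) * pw (fromN k) l)))
    ∎
    where
      pull : ∀ l → sign k * (fromN (bin n k) * (fromN (bin m l) * pw (fromN k) l))
                 ≈ fromN (bin m l) * (sign k * (fromN (bin n k) * pw (fromN k) l))
      pull l = solve 4 (λ s b c x → s :* (b :* (c :* x)) := c :* (s :* (b :* x))) refl
                 (sign k) (fromN (bin n k)) (fromN (bin m l)) (pw (fromN k) l)

  -- Δ(n+1,m) = - Σ_{l<m} C(m,l) Δ(n,l): split C(n+1,k) by Pascal's rule; the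
  -- unshifted half is Δ(n,m), the shifted half is -Σ_{l≤m} C(m,l) Δ(n,l).
  alternatingSum-suc : ∀ n m → alternatingSum (suc n) m ≈ (- 1#) * sumTo m (λ l → fromN (bin m l) * alternatingSum n l)
  alternatingSum-suc n m = begin
      alternatingSum (suc n) m
    ≈⟨ Σ-shift (suc n) e1 ⟩
      e1 0 + sumTo (suc n) (λ k → e1 (suc k))
    ≈⟨ +-congˡ (trans (Σ-cong′ (suc n) (λ k → trans (*-congˡ (trans (*-congʳ (fromN-+ (bin n k) (bin n (suc k)))) (distribʳ _ _ _)))
                                                   (distribˡ _ _ _)))
                      (Σ-+ (suc n) A B)) ⟩
      e1 0 + (sumTo (suc n) A + sumTo (suc n) B)
    ≈⟨ trans (+-congˡ (+-comm _ _)) (sym (+-assoc _ _ _)) ⟩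
      (e1 0 + sumTo (suc n) B) + sumTo (suc n) A
    ≈⟨ +-cong unshifted shifted ⟩
      alternatingSum n m + (- 1#) * (X + fromN (bin m m) * alternatingSum n m)
    ≈⟨ +-congˡ (*-congˡ (+-congˡ (trans (*-congʳ (trans (reflexive (P.cong fromN (bin-n-n m))) fromN-1)) (*-identityˡ _)))) ⟩
      alternatingSum n m + (- 1#) * (X + alternatingSum n m)
    ≈⟨ +-congˡ (distribˡ _ _ _) ⟩
      alternatingSum n m + ((- 1#) * X + (- 1#) * alternatingSum n m)
    ≈⟨ trans (+-congˡ (+-comm _ _)) (sym (+-assoc _ _ _)) ⟩
      (alternatingSum n m + (- 1#) * alternatingSum n m) + (- 1#) * X
    ≈⟨ +-congʳ (trans (+-congˡ (-1*x≈-x _)) (-‿inverseʳ _)) ⟩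
      0# + (- 1#) * X
    ≈⟨ +-identityˡ _ ⟩
      (- 1#) * X
    ∎
    where
      X : Carrier
      X = sumTo m (λ l → fromN (bin m l) * alternatingSum n l)
      e1 : ℕ → Carrier
      e1 = λ k → sign k * (fromN (bin (suc n) k) * pw (fromN k) m)
      e0 : ℕ → Carrier
      e0 = λ k → sign k * (fromN (bin n k) * pw (fromN k) m)
      A : ℕ → Carrier
      A = λ k → sign (suc k) * (fromN (bin n k) * pw (fromN (suc k)) m)
      B : ℕ → Carrier
      B = λ k → sign (suc k) * (fromN (bin n (suc k)) * pw (fromN (suc k)) m)
      unshifted : e1 0 + sumTo (suc n) B ≈ alternatingSum n m
      unshifted = begin
          e0 0 + sumTo (suc n) (λ k → e0 (suc k))
        ≈⟨ sym (Σ-shift (suc n) e0) ⟩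
          sumTo (suc n) e0 + e0 (suc n)
        ≈⟨ +-congˡ (trans (*-congˡ (trans (*-congʳ (reflexive (P.cong fromN (bin-> n (suc n) ℕP.≤-refl)))) (zeroˡ _))) (zeroʳ _)) ⟩
          alternatingSum n m + 0#
        ≈⟨ +-identityʳ _ ⟩
          alternatingSum n m
        ∎
      shifted : sumTo (suc n) A ≈ (- 1#) * sumTo (suc m) (λ l → fromN (bin m l) * alternatingSum n l)
      shifted = begin
          sumTo (suc n) A
        ≈⟨ Σ-cong′ (suc n) (shifted-term n m) ⟩
          sumTo (suc n) (λ k → (- 1#) * sumTo (suc m) (λ l → fromN (bin m l) * e n k l))
        ≈⟨ sym (Σ-*ˡ (suc n) _ _) ⟩
          (- 1#) * sumTo (suc n) (λ k → sumTo (suc m) (λ l → fromN (bin m l) * e n k l))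
        ≈⟨ *-congˡ (Σ-swap (suc n) (suc m) _) ⟩
          (- 1#) * sumTo (suc m) (λ l → sumTo (suc n) (λ k → fromN (bin m l) * e n k l))
        ≈⟨ *-congˡ (Σ-cong′ (suc m) (λ l → sym (Σ-*ˡ (suc n) (fromN (bin m l)) _))) ⟩
          (- 1#) * sumTo (suc m) (λ l → fromN (bin m l) * alternatingSum n l)
        ∎
        where e : ℕ → ℕ → ℕ → Carrier
              e = λ n k l → sign k * (fromN (bin n k) * pw (fromN k) l)

  alternatingSum-below : ∀ n m → m < n → alternatingSum n m ≈ 0#
  alternatingSum-below (suc n) m m<sn =
    trans (alternatingSum-suc n m)
      (trans (*-congˡ (Σ-vanish m (λ l l<m →
                trans (*-congˡ (alternatingSum-below n l (ℕP.<-≤-trans l<m (ℕP.≤-pred m<sn)))) (zeroʳ _))))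
             (zeroʳ _))

  alternatingSum-diagonal : ∀ n → alternatingSum n n ≈ sign n * fromN (n !)
  alternatingSum-diagonal zero = trans (+-identityˡ _) (*-congˡ (*-identityʳ _))
  alternatingSum-diagonal (suc n) = begin
      alternatingSum (suc n) (suc n)
    ≈⟨ alternatingSum-suc n (suc n) ⟩
      (- 1#) * (sumTo n (λ l → fromN (bin (suc n) l) * alternatingSum n l) + fromN (bin (suc n) n) * alternatingSum n n)
    ≈⟨ *-congˡ (+-cong (Σ-vanish n (λ l l<n → trans (*-congˡ (alternatingSum-below n l l<n)) (zeroʳ _)))
                       (*-cong (reflexive (P.cong fromN (bin-sn-n n))) (alternatingSum-diagonal n))) ⟩
      (- 1#) * (0# + fromN (suc n) * (sign n * fromN (n !)))
    ≈⟨ *-congˡ (+-identityˡ _) ⟩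
      (- 1#) * (fromN (suc n) * (sign n * fromN (n !)))
    ≈⟨ solve 4 (λ u a s f → u :* (a :* (s :* f)) := (s :* u) :* (a :* f)) refl (- 1#) (fromN (suc n)) (sign n) (fromN (n !)) ⟩
      sign (suc n) * (fromN (suc n) * fromN (n !))
    ≈⟨ *-congˡ (sym (fromN-* (suc n) (n !))) ⟩
      sign (suc n) * fromN (suc n !)
    ∎

module PowerSumsModP (S : CommutativeRing 0ℓ 0ℓ) {p : ℕ} (pp : Prime p)
  (char : CommutativeRing._≈_ S (RingArithmetic.fromN S p) (CommutativeRing.0# S))
  (cancelN : ∀ {a b n} → ¬ p ℕD.∣ n →
             CommutativeRing._≈_ S (CommutativeRing._*_ S a (RingArithmetic.fromN S n))
                                   (CommutativeRing._*_ S b (RingArithmetic.fromN S n)) →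
             CommutativeRing._≈_ S a b) where
  open PrimeFacts pp
  open CommutativeRing S
  open Trunc 0# 1# _+_ _*_ using (sumTo)
  open FiniteSums S
  open RingArithmetic S
  open PowerSums S
  open Frobenius S pp
  open Binomial
  open SetoidReasoning setoid
  open RingProps ring using (-1*x≈-x; -‿involutive; +-inverseʳ-unique)

  p≡1+[p-1] : p ≡ suc (p ∸ 1)
  p≡1+[p-1] = P.sym (ℕP.m+[n∸m]≡n (ℕP.<⇒≤ 1<p))

  1≤p-1 : 1 ≤ p ∸ 1
  1≤p-1 = ℕP.≤-pred (P.subst (2 ≤_) p≡1+[p-1] 1<p)

  fermat : ∀ a → pw (fromN a) p ≈ fromN a
  fermat zero = pw-zero p (ℕP.<⇒≤ 1<p)
  fermat (suc a) = trans (frobenius char (fromN a) 1#) (+-cong (fermat a) (pw-one p))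

  fermat′ : ∀ a → ¬ p ℕD.∣ a → pw (fromN a) (p ∸ 1) ≈ 1#
  fermat′ a nd = cancelN nd (trans (reflexive (P.cong (pw (fromN a)) (P.sym p≡1+[p-1])))
                   (trans (fermat a) (sym (*-identityˡ _))))

  σ : ℕ → Carrier
  σ n = powerSum p n

  σ-zero : σ 0 ≈ 0#
  σ-zero = trans (Σ-ones p) char

  -- (n+2)·σ(n+1) = p^(n+2) - Σ_{k≤n} C(n+2,k) σ(k) ≈ 0 once the lower σ(k) vanish.
  σ-step : ∀ n → n ℕ.+ 2 < p → (∀ j → j < n → σ (suc j) ≈ 0#) → σ (suc n) ≈ 0#
  σ-step n n+2<p lower =
    cancelN {σ (suc n)} {0#} {suc (suc n)} ¬p∣n+2 (trans (*-comm _ _) (trans leading (sym (zeroˡ _))))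
    where
      ¬p∣n+2 : ¬ p ℕD.∣ suc (suc n)
      ¬p∣n+2 = ¬p∣small (suc (suc n)) ℕ.z<s (P.subst (_< p) (ℕP.+-comm n 2) n+2<p)
      term : ℕ → Carrier
      term = λ k → fromN (bin (suc (suc n)) k) * σ k
      leading : fromN (suc (suc n)) * σ (suc n) ≈ 0#
      leading = begin
          fromN (suc (suc n)) * σ (suc n)
        ≈⟨ *-congʳ (reflexive (P.cong fromN (P.sym (bin-sn-n (suc n))))) ⟩
          term (suc n)
        ≈⟨ sym (+-identityˡ _) ⟩
          0# + term (suc n)
        ≈⟨ +-congʳ (sym (trans (Σ-shift n term) (trans (+-cong (trans (*-congˡ σ-zero) (zeroʳ _))
              (Σ-vanish n (λ k k<n → trans (*-congˡ (lower k k<n)) (zeroʳ _)))) (+-identityʳ 0#)))) ⟩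
          sumTo (suc n) term + term (suc n)
        ≈⟨ powerSum-recurrence p (suc n) ⟩
          pw (fromN p) (suc (suc n))
        ≈⟨ trans (pw-cong (suc (suc n)) char) (pw-zero (suc (suc n)) (s≤s z≤n)) ⟩
          0#
        ∎

  σ-small-upto : ∀ n → n ℕ.+ 2 < p → ∀ k → k ≤ n → σ (suc k) ≈ 0#
  σ-small-upto zero n+2<p zero z≤n = σ-step 0 n+2<p (λ j ())
  σ-small-upto (suc n) n+2<p k k≤sn with ℕP.m≤n⇒m<n∨m≡n k≤sn
  ... | inj₁ k<sn = σ-small-upto n (ℕP.<-trans (ℕP.n<1+n _) n+2<p) k (ℕP.≤-pred k<sn)
  ... | inj₂ P.refl = σ-step (suc n) n+2<p (λ j j<sn → σ-small-upto n (ℕP.<-trans (ℕP.n<1+n _) n+2<p) j (ℕP.≤-pred j<sn))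

  σ-small : ∀ n → 1 ≤ n → n ℕ.+ 1 < p → σ n ≈ 0#
  σ-small (suc n) _ n+2<p = σ-small-upto n (P.subst (_< p) (P.sym (ℕP.+-suc n 1)) n+2<p) n ℕP.≤-refl

  -- by Fermat, σ is periodic with period p - 1 on positive exponents
  σ-periodic : ∀ n → 1 ≤ n → σ (n ℕ.+ (p ∸ 1)) ≈ σ n
  σ-periodic n 1≤n = Σ-cong p shift
    where
      shift : ∀ i → i < p → pw (fromN i) (n ℕ.+ (p ∸ 1)) ≈ pw (fromN i) n
      shift zero _ = trans (pw-zero (n ℕ.+ (p ∸ 1)) (ℕP.≤-trans 1≤n (ℕP.m≤m+n n (p ∸ 1)))) (sym (pw-zero n 1≤n))
      shift (suc i) si<p = trans (pw-+ _ n (p ∸ 1)) (trans (*-congˡ (fermat′ (suc i) (¬p∣small (suc i) ℕ.z<s si<p))) (*-identityʳ _))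

  -- σ(p-1) = Σ_{0<i<p} 1 = p - 1 ≈ -1
  σ-p-1 : σ (p ∸ 1) ≈ - 1#
  σ-p-1 = begin
      sumTo p (λ i → pw (fromN i) (p ∸ 1))
    ≡⟨ P.cong (λ q → sumTo q (λ i → pw (fromN i) (p ∸ 1))) p≡1+[p-1] ⟩
      sumTo (suc (p ∸ 1)) (λ i → pw (fromN i) (p ∸ 1))
    ≈⟨ Σ-shift (p ∸ 1) _ ⟩
      pw 0# (p ∸ 1) + sumTo (p ∸ 1) (λ i → pw (fromN (suc i)) (p ∸ 1))
    ≈⟨ +-cong (pw-zero (p ∸ 1) 1≤p-1)
              (Σ-cong (p ∸ 1) (λ i i<p-1 → fermat′ (suc i)
                 (¬p∣small (suc i) ℕ.z<s (P.subst (suc (suc i) ≤_) (P.sym p≡1+[p-1]) (s≤s i<p-1))))) ⟩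
      0# + sumTo (p ∸ 1) (λ _ → 1#)
    ≈⟨ trans (+-identityˡ _) (Σ-ones (p ∸ 1)) ⟩
      fromN (p ∸ 1)
    ≈⟨ +-inverseʳ-unique 1# (fromN (p ∸ 1)) (trans (+-comm _ _) (trans (reflexive (P.cong fromN (P.sym p≡1+[p-1]))) char)) ⟩
      - 1#
    ∎

  σ-2p-2 : σ ((p ∸ 1) ℕ.+ (p ∸ 1)) ≈ - 1#
  σ-2p-2 = trans (σ-periodic (p ∸ 1) 1≤p-1) σ-p-1

  σ-vanishes : ∀ n → n < (p ∸ 1) ℕ.+ (p ∸ 1) → n ≢ p ∸ 1 → σ n ≈ 0#
  σ-vanishes zero _ _ = σ-zero
  σ-vanishes (suc i) i<M ne with suc i <? p ∸ 1
  ... | yes lt = σ-small (suc i) (s≤s z≤n)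
                   (P.subst (λ z → suc z ≤ p) (ℕP.+-comm 1 (suc i))
                      (P.subst (suc (suc (suc i)) ≤_) (P.sym p≡1+[p-1]) (s≤s lt)))
  ... | no nlt = trans (reflexive (P.cong σ (P.sym m+[p-1]≡n))) (trans (σ-periodic m 1≤m) (σ-small m 1≤m m+1<p))
    where
      p-1<n : p ∸ 1 < suc i
      p-1<n = ℕP.≤∧≢⇒< (ℕP.≮⇒≥ nlt) (λ e → ne (P.sym e))
      m : ℕ
      m = suc i ∸ (p ∸ 1)
      m+[p-1]≡n : m ℕ.+ (p ∸ 1) ≡ suc i
      m+[p-1]≡n = ℕP.m∸n+n≡m (ℕP.<⇒≤ p-1<n)
      1≤m : 1 ≤ m
      1≤m = P.subst (_< m) (ℕP.n∸n≡0 (p ∸ 1)) (ℕP.∸-monoˡ-< {p ∸ 1} {p ∸ 1} {suc i} p-1<n ℕP.≤-refl)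
      m<p-1 : m < p ∸ 1
      m<p-1 = ℕP.+-cancelʳ-< (p ∸ 1) m (p ∸ 1) (P.subst (_< (p ∸ 1) ℕ.+ (p ∸ 1)) (P.sym m+[p-1]≡n) i<M)
      m+1<p : m ℕ.+ 1 < p
      m+1<p = P.subst₂ (λ u v → suc u ≤ v) (ℕP.+-comm 1 m) (P.sym p≡1+[p-1]) (s≤s m<p-1)

  private
    sign-square : ∀ k → sign k * sign k ≈ 1#
    sign-square k = trans (sym (pw-* (- 1#) (- 1#) k))
                      (trans (pw-cong k (trans (-1*x≈-x (- 1#)) (-‿involutive 1#))) (pw-one k))

    bin-p-1 : ∀ k → k ≤ p ∸ 1 → fromN (bin (p ∸ 1) k) ≈ sign k
    bin-p-1 zero _ = fromN-1
    bin-p-1 (suc k) sk≤ = begin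
        fromN (bin (p ∸ 1) (suc k))
      ≈⟨ +-inverseʳ-unique _ _ pascal ⟩
        - fromN (bin (p ∸ 1) k)
      ≈⟨ -‿cong (bin-p-1 k (ℕP.<⇒≤ sk≤)) ⟩
        - sign k
      ≈⟨ sym (trans (*-comm _ _) (-1*x≈-x (sign k))) ⟩
        sign k * (- 1#)
      ∎
      where
        pascal : fromN (bin (p ∸ 1) k) + fromN (bin (p ∸ 1) (suc k)) ≈ 0#
        pascal = trans (sym (fromN-+ (bin (p ∸ 1) k) (bin (p ∸ 1) (suc k))))
                   (trans (reflexive (P.cong (λ q → fromN (bin q (suc k))) (P.sym p≡1+[p-1])))
                     (fromN-bin char (suc k) ℕ.z<s (P.subst (suc k <_) (P.sym p≡1+[p-1]) (s≤s sk≤))))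

  -- σ(p-1) ≈ (p-1)!, since Σ_{k≤p-1} k^(p-1) is the (p-1)-th alternating sum
  -- of k^(p-1) (the binomial signs cancel) and, for odd p, p - 1 is even.
  σ-p-1≈factorial : p ≢ 2 → σ (p ∸ 1) ≈ fromN ((p ∸ 1) !)
  σ-p-1≈factorial p≢2 = begin
      sumTo p (λ i → pw (fromN i) (p ∸ 1))
    ≡⟨ P.cong (λ q → sumTo q (λ i → pw (fromN i) (p ∸ 1))) p≡1+[p-1] ⟩
      sumTo (suc (p ∸ 1)) (λ i → pw (fromN i) (p ∸ 1))
    ≈⟨ Σ-cong (suc (p ∸ 1)) (λ k k< → trans (sym (*-identityˡ _)) (trans (*-congʳ (sym (sign-square k)))
          (trans (*-assoc _ _ _) (*-congˡ (*-congʳ (sym (bin-p-1 k (ℕP.≤-pred k<)))))))) ⟩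
      alternatingSum (p ∸ 1) (p ∸ 1)
    ≈⟨ alternatingSum-diagonal (p ∸ 1) ⟩
      sign (p ∸ 1) * fromN ((p ∸ 1) !)
    ≈⟨ trans (*-congʳ even-sign) (*-identityˡ _) ⟩
      fromN ((p ∸ 1) !)
    ∎
    where
      even-sign : sign (p ∸ 1) ≈ 1#
      even-sign with odd-prime p≢2
      ... | r , e = trans (reflexive (P.cong sign (P.trans (P.cong (_∸ 1) e) (P.cong (r ℕ.+_) (ℕP.+-identityʳ r)))))
                      (trans (pw-+ (- 1#) r r) (sign-square r))

module ZmodFacts {p : ℕ} (pp : Prime p) where
  open IntegersModP p
  open CommutativeRing Zmod
  open RingArithmetic Zmod

  fromN≡ : ∀ n → fromN n ≡ + n
  fromN≡ zero = P.refl
  fromN≡ (suc n) = P.trans (P.cong (ℤ._+ 1ℤ) (fromN≡ n)) (P.cong +_ (ℕP.+-comm n 1))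

  char : fromN p ≈ 0#
  char = trans (reflexive (fromN≡ p)) (mk (dv⇒≈0 {+ p} ℕD.∣-refl))

  cancelN : ∀ {a b n} → ¬ p ℕD.∣ n → (a * fromN n) ≈ (b * fromN n) → a ≈ b
  cancelN {n = n} nd = Prime-cancel.cancel pp (λ d → nd (P.subst (λ z → p ℕD.∣ ℤ.∣ z ∣) (fromN≡ n) d))

module Orders (R : CommutativeRing 0ℓ 0ℓ) where
  open CommutativeRing R
  open Bivariate R
  open FiniteSums R

  AdditiveWeight : (ℕ → ℕ → ℕ) → Set
  AdditiveWeight w = ∀ i j a b → i ≤ a → j ≤ b → w a b ≡ w i j ℕ.+ w (a ∸ i) (b ∸ j)

  HasOrder : (ℕ → ℕ → ℕ) → ℕ → Pol → Set
  HasOrder w d f = ∀ a b → w a b < d → f a b ≈ 0#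

  order-⊗ : ∀ w → AdditiveWeight w → ∀ {d e f g} → HasOrder w d f → HasOrder w e g → HasOrder w (d ℕ.+ e) (f ⊗ g)
  order-⊗ w add {d} {e} {f} {g} of og a b lt =
    Σ-vanish (suc a) (λ i i<a → Σ-vanish (suc b) (λ j j<b → term i j (ℕP.≤-pred i<a) (ℕP.≤-pred j<b)))
    where
      -- one of the two factors has weight below its order
      term : ∀ i j → i ≤ a → j ≤ b → f i j * g (a ∸ i) (b ∸ j) ≈ 0#
      term i j i≤a j≤b with w i j <? d
      ... | yes x = trans (*-congʳ (of i j x)) (zeroˡ _)
      ... | no x = trans (*-congˡ (og (a ∸ i) (b ∸ j) lt′)) (zeroʳ _)
        where
          lt′ : w (a ∸ i) (b ∸ j) < e
          lt′ = ℕP.+-cancelˡ-< d _ _ (ℕP.≤-<-trans (ℕP.+-monoˡ-≤ _ (ℕP.≮⇒≥ x)) (P.subst (_< d ℕ.+ e) (add i j a b i≤a j≤b) lt))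

  order-^ : ∀ w → AdditiveWeight w → ∀ {g} → HasOrder w 1 g → ∀ n → HasOrder w n (g ^P n)
  order-^ w add og zero a b ()
  order-^ w add {g} og (suc n) a b lt = order-⊗ w add (order-^ w add og n) og a b (P.subst (w a b <_) (ℕP.+-comm 1 n) lt)

  weight₀ : AdditiveWeight (λ a b → a)
  weight₀ i j a b i≤a _ = P.sym (ℕP.m+[n∸m]≡n i≤a)

  weight₁ : AdditiveWeight (λ a b → b)
  weight₁ i j a b _ j≤b = P.sym (ℕP.m+[n∸m]≡n j≤b)

  degree : AdditiveWeight (λ a b → a ℕ.+ b)
  degree i j a b i≤a j≤b = P.trans (P.cong₂ ℕ._+_ (weight₀ i j a b i≤a j≤b) (weight₁ i j a b i≤a j≤b))
                                   (regroup i j (a ∸ i) (b ∸ j))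
    where regroup : ∀ x y z u → (x ℕ.+ z) ℕ.+ (y ℕ.+ u) ≡ (x ℕ.+ y) ℕ.+ (z ℕ.+ u)
          regroup = ℕSolver.solve-∀

  power-vanishes : ∀ {g} → g 0 0 ≈ 0# → ∀ K n → (2 ℕ.* K ∸ 1) ≤ n → ∀ a b → a < K → b < K → (g ^P n) a b ≈ 0#
  power-vanishes {g} g0 (suc K) n le a b a<K b<K = order-^ (λ a b → a ℕ.+ b) degree order-1 n a b (ℕP.<-≤-trans lt le)
    where
      order-1 : HasOrder (λ a b → a ℕ.+ b) 1 g
      order-1 zero zero _ = g0
      order-1 zero (suc b) (s≤s ())
      order-1 (suc a) b (s≤s ())
      lt : a ℕ.+ b < 2 ℕ.* suc K ∸ 1
      lt = ℕP.≤-trans (s≤s (ℕP.+-mono-≤ (ℕP.≤-pred a<K) (ℕP.≤-pred b<K)))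
             (ℕP.≤-reflexive (P.sym (P.trans (ℕP.+-suc K (K ℕ.+ 0)) (P.cong (λ z → suc (K ℕ.+ z)) (ℕP.+-identityʳ K)))))

  y₀ : Pol
  y₀ (suc zero) zero = 1#
  y₀ _ _ = 0#

  y₁ : Pol
  y₁ zero (suc zero) = 1#
  y₁ _ _ = 0#

  y₀-order : HasOrder (λ a b → a) 1 y₀
  y₀-order zero b _ = refl
  y₀-order (suc a) b (s≤s ())

  y₁-order : HasOrder (λ a b → b) 1 y₁
  y₁-order zero zero _ = refl
  y₁-order (suc a) zero _ = refl
  y₁-order a (suc b) (s≤s ())

  -- g(0,0) = 0 ⇒ g = y₀·(g - g(0,y₁))/y₀ + y₁·g(0,y₁)/y₁
  module Decomposition (g : Pol) where
    quotient₀ : Pol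
    quotient₀ a b = g (suc a) b

    quotient₁ : Pol
    quotient₁ zero b = g 0 (suc b)
    quotient₁ (suc a) b = 0#

    private
      part₀ : Pol
      part₀ zero b = 0#
      part₀ (suc a) b = g (suc a) b

      part₁ : Pol
      part₁ a zero = 0#
      part₁ a (suc b) = quotient₁ a b

      y₀-times : ∀ a b → (y₀ ⊗ quotient₀) a b ≈ part₀ a b
      y₀-times zero b = trans (+-identityˡ _) (Σ-vanish (suc b) (λ j _ → zeroˡ _))
      y₀-times (suc a) b = trans (Σ-single (suc (suc a)) 1 _ other-i (s≤s (s≤s z≤n)))
        (trans (Σ-single (suc b) 0 _ other-j (s≤s z≤n)) (*-identityˡ _))
        where
          other-i : ∀ i → i < suc (suc a) → i ≢ 1 → sumTo (suc b) (λ j → y₀ i j * quotient₀ (suc a ∸ i) (b ∸ j)) ≈ 0#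
          other-i zero _ _ = Σ-vanish (suc b) (λ j _ → zeroˡ _)
          other-i (suc zero) _ ne = ⊥-elim (ne P.refl)
          other-i (suc (suc i)) _ _ = Σ-vanish (suc b) (λ j _ → zeroˡ _)
          other-j : ∀ j → j < suc b → j ≢ 0 → y₀ 1 j * quotient₀ (suc a ∸ 1) (b ∸ j) ≈ 0#
          other-j zero _ ne = ⊥-elim (ne P.refl)
          other-j (suc j) _ _ = zeroˡ _

      y₁-times : ∀ a b → (y₁ ⊗ quotient₁) a b ≈ part₁ a b
      y₁-times a b = trans (Σ-single (suc a) 0 _ other-i (s≤s z≤n)) (column b)
        where
          other-i : ∀ i → i < suc a → i ≢ 0 → sumTo (suc b) (λ j → y₁ i j * quotient₁ (a ∸ i) (b ∸ j)) ≈ 0#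
          other-i zero _ ne = ⊥-elim (ne P.refl)
          other-i (suc i) _ _ = Σ-vanish (suc b) (λ j _ → zeroˡ _)
          column : ∀ b → sumTo (suc b) (λ j → y₁ 0 j * quotient₁ a (b ∸ j)) ≈ part₁ a b
          column zero = trans (+-identityˡ _) (zeroˡ _)
          column (suc b) = trans (Σ-single (suc (suc b)) 1 _ other-j (s≤s (s≤s z≤n))) (*-identityˡ _)
            where
              other-j : ∀ j → j < suc (suc b) → j ≢ 1 → y₁ 0 j * quotient₁ a (suc b ∸ j) ≈ 0#
              other-j zero _ _ = zeroˡ _
              other-j (suc zero) _ ne = ⊥-elim (ne P.refl)
              other-j (suc (suc j)) _ _ = zeroˡ _

    decomposition : g 0 0 ≈ 0# → g ≐ ((y₀ ⊗ quotient₀) ⊕ (y₁ ⊗ quotient₁))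
    decomposition g0 a b = sym (trans (+-cong (y₀-times a b) (y₁-times a b)) (collect a b))
      where
        collect : ∀ a b → part₀ a b + part₁ a b ≈ g a b
        collect zero zero = trans (+-identityˡ _) (sym g0)
        collect zero (suc b) = +-identityˡ _
        collect (suc a) zero = +-identityʳ _
        collect (suc a) (suc b) = +-identityʳ _

-- In characteristic p, g(0,0) = 0 ⇒ g^n ≈ 0 in R[y₀,y₁]/⟨y₀^p,y₁^p⟩ for n ≥ p:
-- g^p = y₀^p·A^p + y₁^p·B^p by the Frobenius.
module FrobeniusVanishing (R : CommutativeRing 0ℓ 0ℓ) {p : ℕ} (pp : Prime p)
  (char : CommutativeRing._≈_ R (RingArithmetic.fromN R p) (CommutativeRing.0# R)) where
  open CommutativeRing R
  open Bivariate R
  open Orders R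
  open Truncation p
  private
    module T = CommutativeRing truncatedRing
    module TA = RingArithmetic truncatedRing
    module TF = Frobenius truncatedRing pp

  fromN-constant : ∀ n a b → TA.fromN n a b ≈ RingArithmetic.fromN R n * oneP a b
  fromN-constant zero a b = sym (zeroˡ _)
  fromN-constant (suc n) a b = trans (+-cong (fromN-constant n a b) (sym (*-identityˡ _))) (sym (distribʳ _ _ _))

  char-truncated : TA.fromN p ≈T zeroP
  char-truncated a b _ _ = trans (fromN-constant p a b) (trans (*-congʳ char) (zeroˡ _))

  ^p-vanishes : ∀ g → g 0 0 ≈ 0# → (g ^P p) ≈T zeroP
  ^p-vanishes g g0 = T.trans (T.sym (pw≈^P g p)) (begin
      TA.pw g p
    ≈⟨ TA.pw-cong p (pt (decomposition g0)) ⟩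
      TA.pw ((y₀ ⊗ quotient₀) ⊕ (y₁ ⊗ quotient₁)) p
    ≈⟨ TF.frobenius char-truncated (y₀ ⊗ quotient₀) (y₁ ⊗ quotient₁) ⟩
      TA.pw (y₀ ⊗ quotient₀) p ⊕ TA.pw (y₁ ⊗ quotient₁) p
    ≈⟨ T.+-cong (TA.pw-* y₀ quotient₀ p) (TA.pw-* y₁ quotient₁ p) ⟩
      (TA.pw y₀ p ⊗ TA.pw quotient₀ p) ⊕ (TA.pw y₁ p ⊗ TA.pw quotient₁ p)
    ≈⟨ T.+-cong (T.*-congʳ {TA.pw quotient₀ p} y₀^p) (T.*-congʳ {TA.pw quotient₁ p} y₁^p) ⟩
      (zeroP ⊗ TA.pw quotient₀ p) ⊕ (zeroP ⊗ TA.pw quotient₁ p)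
    ≈⟨ T.trans (T.+-cong (T.zeroˡ (TA.pw quotient₀ p)) (T.zeroˡ (TA.pw quotient₁ p))) (T.+-identityˡ zeroP) ⟩
      zeroP
    ∎)
    where
      open Decomposition g
      open SetoidReasoning T.setoid
      y₀^p : TA.pw y₀ p ≈T zeroP
      y₀^p a b a<p b<p = trans (pw≈^P y₀ p a b a<p b<p) (order-^ (λ a b → a) weight₀ y₀-order p a b a<p)
      y₁^p : TA.pw y₁ p ≈T zeroP
      y₁^p a b a<p b<p = trans (pw≈^P y₁ p a b a<p b<p) (order-^ (λ a b → b) weight₁ y₁-order p a b b<p)

  ^n-vanishes : ∀ g → g 0 0 ≈ 0# → ∀ n → p ≤ n → (g ^P n) ≈T zeroP
  ^n-vanishes g g0 n p≤n = T.trans (T.sym (pw≈^P g n)) (begin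
      TA.pw g n
    ≡⟨ P.cong (TA.pw g) (P.sym (ℕP.m+[n∸m]≡n p≤n)) ⟩
      TA.pw g (p ℕ.+ (n ∸ p))
    ≈⟨ TA.pw-+ g p (n ∸ p) ⟩
      TA.pw g p ⊗ TA.pw g (n ∸ p)
    ≈⟨ T.*-congʳ {TA.pw g (n ∸ p)} (T.trans (pw≈^P g p) (^p-vanishes g g0)) ⟩
      zeroP ⊗ TA.pw g (n ∸ p)
    ≈⟨ T.zeroˡ (TA.pw g (n ∸ p)) ⟩
      zeroP
    ∎)
    where open SetoidReasoning T.setoid

-- Substituting a nilpotent G into truncated power series, and the identity
-- exp(G)^i = Σ_n i^n G^n/n! in R[y₀,y₁]/⟨y₀^K,y₁^K⟩, phrased for any
-- "divided-power" sequence ι with ι(a)·ι(n-a) = C(n,a)·ι(n) (e.g. ι(n) = 1/n!).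
module ExponentialPowers (R : CommutativeRing 0ℓ 0ℓ) (K : ℕ) where
  open CommutativeRing R
  open Bivariate R
  open Truncation K
  open FiniteSums R
  open RingArithmetic R
  open Binomial
  private
    module T = CommutativeRing truncatedRing
    module TA = RingArithmetic truncatedRing
    module TS = FiniteSums truncatedRing
    module TT = Trunc T.0# T.1# T._+_ T._*_
    module TSolver = NatCoeffSolver T.commutativeSemiring

  scale-⊗ : ∀ c f g → (scale c f ⊗ g) ≐ scale c (f ⊗ g)
  scale-⊗ c f g a b = trans (Σ-cong′ (suc a) (λ i → trans (Σ-cong′ (suc b) (λ j → *-assoc _ _ _)) (sym (Σ-*ˡ (suc b) c _))))
                        (sym (Σ-*ˡ (suc a) c _))

  C : Carrier → Pol
  C c = scale c oneP

  scale-C : ∀ c f → scale c f ≐ (C c ⊗ f)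
  scale-C c f a b = sym (trans (scale-⊗ c oneP f a b) (*-congˡ (⊗-identityˡ f a b)))

  C-cong : ∀ {c d} → c ≈ d → C c ≈T C d
  C-cong e a b _ _ = *-congʳ e

  C-* : ∀ c d → C (c * d) ≈T (C c ⊗ C d)
  C-* c d a b _ _ = sym (trans (scale-⊗ c oneP (C d) a b) (trans (*-congˡ (⊗-identityˡ (C d) a b)) (sym (*-assoc _ _ _))))

  C-0 : C 0# ≈T zeroP
  C-0 a b _ _ = zeroˡ _

  C-1 : C 1# ≈T oneP
  C-1 a b _ _ = *-identityˡ _

  C-Σ : ∀ n h → C (sumTo n h) ≈T TT.sumTo n (λ i → C (h i))
  C-Σ zero h = C-0
  C-Σ (suc n) h = T.trans (λ a b _ _ → distribʳ _ _ _) (T.+-congʳ (C-Σ n h))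

  module Substitution (G : Pol) (M : ℕ) (nilpotent : ∀ m → suc M ≤ m → TA.pw G m ≈T zeroP) where
    eval : (ℕ → Carrier) → Pol
    eval s = sumP (suc M) (λ n → scale (s n) (G ^P n))

    eval-in-ring : ∀ s → eval s ≈T TT.sumTo (suc M) (λ n → C (s n) T.* TA.pw G n)
    eval-in-ring s = T.trans (T.reflexive (sumP≡sumTo (suc M) _))
      (TS.Σ-cong′ (suc M) (λ n → T.trans (pt (scale-C (s n) (G ^P n))) (T.*-congˡ {C (s n)} (T.reflexive (P.sym (pw≡^P G n))))))

    eval-cong : ∀ {s t} → (∀ n → s n ≈ t n) → eval s ≈T eval t
    eval-cong {s} {t} e = T.trans (eval-in-ring s)
      (T.trans (TS.Σ-cong′ (suc M) (λ n → T.*-congʳ {TA.pw G n} (C-cong (e n)))) (T.sym (eval-in-ring t)))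

    _⋆_ : (ℕ → Carrier) → (ℕ → Carrier) → ℕ → Carrier
    (s ⋆ t) n = sumTo (suc n) (λ a → s a * t (n ∸ a))

    -- substitution is multiplicative, since G^n = 0 for n > M
    eval-⋆ : ∀ s t → (eval s ⊗ eval t) ≈T eval (s ⋆ t)
    eval-⋆ s t = T.trans (⊗-congT (eval-in-ring s) (eval-in-ring t)) (T.trans product (T.sym (eval-in-ring (s ⋆ t))))
      where
        open SetoidReasoning T.setoid
        N : ℕ
        N = suc M
        sumT : ℕ → (ℕ → Pol) → Pol
        sumT = TT.sumTo
        E′ : (ℕ → Carrier) → Pol
        E′ s = sumT N (λ n → C (s n) T.* TA.pw G n)
        rearrange : ∀ a b → (C (s a) T.* TA.pw G a) T.* (C (t b) T.* TA.pw G b) ≈T (C (s a * t b) T.* TA.pw G (a ℕ.+ b))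
        rearrange a b = T.trans (TSolver.solve 4 (λ x y z w → (x TSolver.:* y) TSolver.:* (z TSolver.:* w) TSolver.:= (x TSolver.:* z) TSolver.:* (y TSolver.:* w)) T.refl
                                   (C (s a)) (TA.pw G a) (C (t b)) (TA.pw G b))
                          (T.*-cong (T.sym (C-* (s a) (t b))) (T.sym (TA.pw-+ G a b)))
        product : (E′ s ⊗ E′ t) ≈T E′ (s ⋆ t)
        product = begin
            E′ s T.* E′ t
          ≈⟨ TS.Σ-*ʳ N (E′ t) _ ⟩
            sumT N (λ a → (C (s a) T.* TA.pw G a) T.* E′ t)
          ≈⟨ TS.Σ-cong′ N (λ a → TS.Σ-*ˡ N _ _) ⟩
            sumT N (λ a → sumT N (λ b → (C (s a) T.* TA.pw G a) T.* (C (t b) T.* TA.pw G b)))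
          ≈⟨ TS.Σ-cong′ N (λ a → TS.Σ-cong′ N (λ b → rearrange a b)) ⟩
            sumT N (λ a → sumT N (λ b → C (s a * t b) T.* TA.pw G (a ℕ.+ b)))
          ≈⟨ TS.Σ-square-triangle M (λ a b → C (s a * t b) T.* TA.pw G (a ℕ.+ b))
               (λ a b le → T.trans (T.*-congˡ {C (s a * t b)} (nilpotent _ le)) (T.zeroʳ (C (s a * t b)))) ⟩
            sumT N (λ n → sumT (suc n) (λ a → C (s a * t (n ∸ a)) T.* TA.pw G (a ℕ.+ (n ∸ a))))
          ≈⟨ TS.Σ-cong′ N (λ n → TS.Σ-cong (suc n) (λ a a<sn → T.*-congˡ {C (s a * t (n ∸ a))}
                (T.reflexive (P.cong (TA.pw G) (ℕP.m+[n∸m]≡n (ℕP.≤-pred a<sn)))))) ⟩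
            sumT N (λ n → sumT (suc n) (λ a → C (s a * t (n ∸ a)) T.* TA.pw G n))
          ≈⟨ TS.Σ-cong′ N (λ n → T.sym (TS.Σ-*ʳ (suc n) (TA.pw G n) _)) ⟩
            sumT N (λ n → sumT (suc n) (λ a → C (s a * t (n ∸ a))) T.* TA.pw G n)
          ≈⟨ TS.Σ-cong′ N (λ n → T.*-congʳ {TA.pw G n} (T.sym (C-Σ (suc n) _))) ⟩
            E′ (s ⋆ t)
          ∎

    module DividedPowers (ι : ℕ → Carrier) (ι0 : ι 0 ≈ 1#)
                         (ι-mult : ∀ n a → a ≤ n → ι a * ι (n ∸ a) ≈ fromN (bin n a) * ι n) where
      private
        module RSolver = NatCoeffSolver commutativeSemiring

      -- coefficients of exp(i·G):  i^n ι(n)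
      expCoeff : ℕ → ℕ → Carrier
      expCoeff i n = pw (fromN i) n * ι n

      expCoeff-⋆ : ∀ i n → (expCoeff i ⋆ expCoeff 1) n ≈ expCoeff (suc i) n
      expCoeff-⋆ i n = begin
          sumTo (suc n) (λ a → (pw (fromN i) a * ι a) * (pw (fromN 1) (n ∸ a) * ι (n ∸ a)))
        ≈⟨ Σ-cong (suc n) (λ a a<sn → regroup a (ℕP.≤-pred a<sn)) ⟩
          sumTo (suc n) (λ a → (fromN (bin n a) * (pw (fromN i) a * pw 1# (n ∸ a))) * ι n)
        ≈⟨ sym (Σ-*ʳ (suc n) (ι n) _) ⟩
          binSum (fromN i) 1# n * ι n
        ≈⟨ *-congʳ (sym (binomial (fromN i) 1# n)) ⟩
          expCoeff (suc i) n
        ∎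
        where
          open SetoidReasoning setoid
          regroup : ∀ a → a ≤ n → (pw (fromN i) a * ι a) * (pw (fromN 1) (n ∸ a) * ι (n ∸ a))
                                  ≈ (fromN (bin n a) * (pw (fromN i) a * pw 1# (n ∸ a))) * ι n
          regroup a a≤n = trans (*-congˡ (*-congʳ (pw-cong (n ∸ a) fromN-1)))
            (trans (RSolver.solve 4 (λ x u y v → (x RSolver.:* u) RSolver.:* (y RSolver.:* v) RSolver.:= (x RSolver.:* y) RSolver.:* (u RSolver.:* v)) refl
                        (pw (fromN i) a) (ι a) (pw 1# (n ∸ a)) (ι (n ∸ a)))
            (trans (*-congˡ (ι-mult n a a≤n))
              (RSolver.solve 4 (λ x y b w → (x RSolver.:* y) RSolver.:* (b RSolver.:* w) RSolver.:= (b RSolver.:* (x RSolver.:* y)) RSolver.:* w) refl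
                        (pw (fromN i) a) (pw 1# (n ∸ a)) (fromN (bin n a)) (ι n))))

      exp-power : ∀ i → TA.pw (eval (expCoeff 1)) i ≈T eval (expCoeff i)
      exp-power zero = T.sym (T.trans (eval-in-ring (expCoeff 0)) (T.trans (TS.Σ-shift M _)
          (T.trans (T.+-cong (T.trans (T.*-congʳ {T.1#} (T.trans (C-cong (trans (*-identityˡ _) ι0)) C-1)) (T.*-identityˡ T.1#))
                             (TS.Σ-vanish M (λ n _ → T.trans (T.*-congʳ {TA.pw G (suc n)} (T.trans (C-cong higher) C-0))
                                                            (T.zeroˡ (TA.pw G (suc n))))))
            (T.+-identityʳ T.1#))))
        where
          higher : ∀ {n} → expCoeff 0 (suc n) ≈ 0#
          higher {n} = trans (*-congʳ (zeroʳ _)) (zeroˡ _)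
      exp-power (suc i) = T.trans (⊗-congT {TA.pw (eval (expCoeff 1)) i} {eval (expCoeff i)} {eval (expCoeff 1)} {eval (expCoeff 1)}
                                           (exp-power i) (T.refl {eval (expCoeff 1)}))
                                  (T.trans (eval-⋆ (expCoeff i) (expCoeff 1)) (eval-cong (expCoeff-⋆ i)))

-- Reduction mod p of p-integral rationals.  `Reduces q x` says that q has a
-- representative n/d with p ∤ d and x·d ≡ n (mod p); this relation is
-- functional in x (mod p) and respects + and ·, and Defs' redQ computes it.
module Reduction {p : ℕ} (pp : Prime p) where
  open IntegersModP p using (Zmod; _≋_; mk)
  open IntegersModP.Prime-cancel p pp using (cancel; euclidℤ)
  open PrimeFacts pp
  private
    module Z = CommutativeRing Zmod
    module ZA = RingArithmetic Zmod
    open ZmodFacts pp using (fromN≡; char; cancelN)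
    open PowerSumsModP Zmod pp char cancelN using (fermat′)
  open SetoidReasoning Z.setoid

  PIntegral : ℚ → Set
  PIntegral q = Σ ℚᵘ λ u → (toℚᵘ q ≃ u) × (¬ p ℕD.∣ ℚᵘ.↧ₙ u)

  record Reduces (q : ℚ) (x : ℤ) : Set where
    constructor reduces
    field witness : Σ ℚᵘ λ u → (toℚᵘ q ≃ u) × (¬ p ℕD.∣ ℚᵘ.↧ₙ u) × (x ℤ.* ℚᵘ.↧ u ≋ ℚᵘ.↥ u)

  integral : ∀ {q x} → Reduces q x → PIntegral q
  integral (reduces (u , e , nd , _)) = u , e , nd

  reduces-resp : ∀ {q x y} → x ≋ y → Reduces q x → Reduces q y
  reduces-resp {q} {x} {y} e (reduces (u , a , b , c)) = reduces (u , a , b , Z.trans (Z.*-congʳ {ℚᵘ.↧ u} {y} {x} (Z.sym e)) c)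

  reduces-≡ : ∀ {q r x} → q ≡ r → Reduces q x → Reduces r x
  reduces-≡ P.refl r = r

  reduces-+ : ∀ {q r x y} → Reduces q x → Reduces r y → Reduces (q ℚ.+ r) (x ℤ.+ y)
  reduces-+ {q} {r} {x} {y} (reduces (mkℚᵘ n d , e1 , nd1 , ex)) (reduces (mkℚᵘ n′ d′ , e2 , nd2 , ey)) =
    reduces (_ , ℚᵘP.≃-trans (ℚP.toℚᵘ-homo-+ q r) (ℚᵘP.+-cong e1 e2) , ¬p∣* nd1 nd2 , cross)
    where
      cross : (x ℤ.+ y) ℤ.* + (suc d ℕ.* suc d′) ≋ (n ℤ.* + suc d′ ℤ.+ n′ ℤ.* + suc d)
      cross = begin
          (x ℤ.+ y) ℤ.* + (suc d ℕ.* suc d′)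
        ≡⟨ P.cong ((x ℤ.+ y) ℤ.*_) (ℤP.pos-* (suc d) (suc d′)) ⟩
          (x ℤ.+ y) ℤ.* (+ suc d ℤ.* + suc d′)
        ≡⟨ expand x y (+ suc d) (+ suc d′) ⟩
          (x ℤ.* + suc d) ℤ.* + suc d′ ℤ.+ (y ℤ.* + suc d′) ℤ.* + suc d
        ≈⟨ Z.+-cong (Z.*-congʳ ex) (Z.*-congʳ ey) ⟩
          n ℤ.* + suc d′ ℤ.+ n′ ℤ.* + suc d
        ∎
        where expand : ∀ x y A B → (x ℤ.+ y) ℤ.* (A ℤ.* B) ≡ (x ℤ.* A) ℤ.* B ℤ.+ (y ℤ.* B) ℤ.* A
              expand = ℤSolver.solve-∀

  reduces-* : ∀ {q r x y} → Reduces q x → Reduces r y → Reduces (q ℚ.* r) (x ℤ.* y)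
  reduces-* {q} {r} {x} {y} (reduces (mkℚᵘ n d , e1 , nd1 , ex)) (reduces (mkℚᵘ n′ d′ , e2 , nd2 , ey)) =
    reduces (_ , ℚᵘP.≃-trans (ℚP.toℚᵘ-homo-* q r) (ℚᵘP.*-cong e1 e2) , ¬p∣* nd1 nd2 , cross)
    where
      cross : (x ℤ.* y) ℤ.* + (suc d ℕ.* suc d′) ≋ (n ℤ.* n′)
      cross = begin
          (x ℤ.* y) ℤ.* + (suc d ℕ.* suc d′)
        ≡⟨ P.cong ((x ℤ.* y) ℤ.*_) (ℤP.pos-* (suc d) (suc d′)) ⟩
          (x ℤ.* y) ℤ.* (+ suc d ℤ.* + suc d′)
        ≡⟨ regroup x y (+ suc d) (+ suc d′) ⟩
          (x ℤ.* + suc d) ℤ.* (y ℤ.* + suc d′)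
        ≈⟨ Z.*-cong ex ey ⟩
          n ℤ.* n′
        ∎
        where regroup : ∀ x y A B → (x ℤ.* y) ℤ.* (A ℤ.* B) ≡ (x ℤ.* A) ℤ.* (y ℤ.* B)
              regroup = ℤSolver.solve-∀

  private
    ¬p∣1 : ¬ p ℕD.∣ 1
    ¬p∣1 d = ℕP.<⇒≱ 1<p (ℕD.∣⇒≤ d)

  reduces-0 : Reduces ℚ.0ℚ 0ℤ
  reduces-0 = reduces (mkℚᵘ 0ℤ 0 , ℚᵘP.≃-refl , ¬p∣1 , Z.refl)

  reduces-1 : Reduces ℚ.1ℚ 1ℤ
  reduces-1 = reduces (mkℚᵘ 1ℤ 0 , ℚᵘP.≃-refl , ¬p∣1 , Z.refl)

  reduces-representative : ∀ {q x n d} → Reduces q x → toℚᵘ q ≃ mkℚᵘ n d → ¬ p ℕD.∣ suc d → x ℤ.* + suc d ≋ n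
  reduces-representative {q} {x} {n} {d} (reduces (mkℚᵘ m e , e1 , nd1 , ex)) e2 nd =
    cancel {x ℤ.* + suc d} {n} {+ suc e} nd1 (begin
      x ℤ.* + suc d ℤ.* + suc e
    ≡⟨ swap x (+ suc d) (+ suc e) ⟩
      x ℤ.* + suc e ℤ.* + suc d
    ≈⟨ Z.*-congʳ ex ⟩
      m ℤ.* + suc d
    ≡⟨ ℚᵘP.drop-*≡* (ℚᵘP.≃-trans (ℚᵘP.≃-sym e1) e2) ⟩
      n ℤ.* + suc e
    ∎)
    where
      swap : ∀ x A B → x ℤ.* A ℤ.* B ≡ x ℤ.* B ℤ.* A
      swap = ℤSolver.solve-∀

  reduces-unique : ∀ {q x y} → Reduces q x → Reduces q y → x ≋ y
  reduces-unique {q} {x} {y} rx (reduces (mkℚᵘ m e , e1 , nd1 , ey)) =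
    cancel {x} {y} {+ suc e} nd1 (Z.trans {x ℤ.* + suc e} {m} {y ℤ.* + suc e} (reduces-representative rx e1 nd1) (Z.sym ey))

  -- n/d reduces to n·d^(p-2), as d^(p-1) ≡ 1 (Fermat)
  reduces-by-inverse : ∀ q u → toℚᵘ q ≃ u → ¬ p ℕD.∣ ℚᵘ.↧ₙ u → Reduces q (ℚᵘ.↥ u ℤ.* + (ℚᵘ.↧ₙ u ℕ.^ (p ∸ 2)))
  reduces-by-inverse q (mkℚᵘ n d) e nd = reduces (mkℚᵘ n d , e , nd , (begin
      n ℤ.* + (suc d ℕ.^ (p ∸ 2)) ℤ.* + suc d
    ≡⟨ ℤP.*-assoc n _ _ ⟩
      n ℤ.* (+ (suc d ℕ.^ (p ∸ 2)) ℤ.* + suc d)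
    ≡⟨ P.cong (n ℤ.*_) (P.trans (P.sym (ℤP.pos-* (suc d ℕ.^ (p ∸ 2)) (suc d))) (P.cong +_ (ℕP.*-comm (suc d ℕ.^ (p ∸ 2)) (suc d)))) ⟩
      n ℤ.* + (suc d ℕ.^ suc (p ∸ 2))
    ≡⟨ P.cong (λ k → n ℤ.* + (suc d ℕ.^ k)) (P.sym (ℕP.+-∸-assoc 1 1<p)) ⟩
      n ℤ.* + (suc d ℕ.^ (p ∸ 1))
    ≡⟨ P.cong (n ℤ.*_) (pos-^ (suc d) (p ∸ 1)) ⟩
      n ℤ.* ZA.pw (ZA.fromN (suc d)) (p ∸ 1)
    ≈⟨ Z.*-congˡ {n} (fermat′ (suc d) nd) ⟩
      n ℤ.* 1ℤ
    ≡⟨ ℤP.*-identityʳ n ⟩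
      n
    ∎))
    where
      pos-^ : ∀ d k → + (d ℕ.^ k) ≡ ZA.pw (ZA.fromN d) k
      pos-^ d zero = P.refl
      pos-^ d (suc k) = P.trans (ℤP.pos-* d (d ℕ.^ k))
        (P.trans (ℤP.*-comm (+ d) (+ (d ℕ.^ k))) (P.cong₂ ℤ._*_ (pos-^ d k) (P.sym (fromN≡ d))))

  -- Defs' redQ is the reduction of every p-integral rational: its reduced
  -- denominator is prime to p as well.
  redQ-reduces : ∀ {q} → PIntegral q → Reduces q (redQ p q)
  redQ-reduces {ℚ.mkℚ n d c} (u , e , nd) = reduces-by-inverse (ℚ.mkℚ n d c) (mkℚᵘ n d) ℚᵘP.≃-refl ¬p∣d+1
    where
      coprime : Coprime ℤ.∣ n ∣ (suc d)
      coprime = Dec.recompute (coprime? ℤ.∣ n ∣ (suc d)) c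
      cross : n ℤ.* ℚᵘ.↧ u ≡ ℚᵘ.↥ u ℤ.* + suc d
      cross = ℚᵘP.drop-*≡* e
      ¬p∣d+1 : ¬ p ℕD.∣ suc d
      ¬p∣d+1 pd with euclidℤ n (ℚᵘ.↧ u) (P.subst (λ z → p ℕD.∣ ℤ.∣ z ∣) (P.sym cross)
                        (P.subst (p ℕD.∣_) (P.sym (ℤP.abs-* (ℚᵘ.↥ u) (+ suc d))) (ℕD.∣n⇒∣m*n ℤ.∣ ℚᵘ.↥ u ∣ pd)))
      ... | inj₁ pn = ℕP.<⇒≢ 1<p (P.sym (coprime (pn , pd)))
      ... | inj₂ pu = nd pu

module RelatedPolynomials (R S : CommutativeRing 0ℓ 0ℓ)
  (_∼_ : CommutativeRing.Carrier R → CommutativeRing.Carrier S → Set)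
  (∼-0 : CommutativeRing.0# R ∼ CommutativeRing.0# S)
  (∼-1 : CommutativeRing.1# R ∼ CommutativeRing.1# S)
  (∼-+ : ∀ {a b x y} → a ∼ x → b ∼ y → CommutativeRing._+_ R a b ∼ CommutativeRing._+_ S x y)
  (∼-* : ∀ {a b x y} → a ∼ x → b ∼ y → CommutativeRing._*_ R a b ∼ CommutativeRing._*_ S x y)
  (K : ℕ) where
  private
    module A = Bivariate R
    module B = Bivariate S

  related-Σ : ∀ n {f g} → (∀ i → i < n → f i ∼ g i) → A.sumTo n f ∼ B.sumTo n g
  related-Σ zero h = ∼-0
  related-Σ (suc n) h = ∼-+ (related-Σ n (λ i i<n → h i (ℕP.m<n⇒m<1+n i<n))) (h n ℕP.≤-refl)

  Related : A.Pol → B.Pol → Set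
  Related f X = ∀ a b → a < K → b < K → f a b ∼ X a b

  related-⊕ : ∀ {f g X Y} → Related f X → Related g Y → Related (f A.⊕ g) (X B.⊕ Y)
  related-⊕ rf rg a b x y = ∼-+ (rf a b x y) (rg a b x y)

  related-⊗ : ∀ {f g X Y} → Related f X → Related g Y → Related (f A.⊗ g) (X B.⊗ Y)
  related-⊗ rf rg a b a<K b<K = related-Σ (suc a) (λ i i<a → related-Σ (suc b) (λ j j<b →
      ∼-* (rf i j (ℕP.≤-<-trans (ℕP.≤-pred i<a) a<K) (ℕP.≤-<-trans (ℕP.≤-pred j<b) b<K))
          (rg (a ∸ i) (b ∸ j) (ℕP.≤-<-trans (ℕP.m∸n≤m a i) a<K) (ℕP.≤-<-trans (ℕP.m∸n≤m b j) b<K))))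

  related-one : Related A.oneP B.oneP
  related-one zero zero _ _ = ∼-1
  related-one zero (suc b) _ _ = ∼-0
  related-one (suc a) b _ _ = ∼-0

  related-^ : ∀ {f X} → Related f X → ∀ n → Related (f A.^P n) (X B.^P n)
  related-^ rf zero = related-one
  related-^ rf (suc n) = related-⊗ (related-^ rf n) rf

  related-sumP : ∀ n {F H} → (∀ i → i < n → Related (F i) (H i)) → Related (A.sumP n F) (B.sumP n H)
  related-sumP zero h a b _ _ = ∼-0
  related-sumP (suc n) h = related-⊕ (related-sumP n (λ i i<n → h i (ℕP.m<n⇒m<1+n i<n))) (h n ℕP.≤-refl)

module IntegersInℚ where
  ℚring : CommutativeRing 0ℓ 0ℓ
  ℚring = ℚP.+-*-commutativeRing

  ℤring : CommutativeRing 0ℓ 0ℓ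
  ℤring = ℤP.+-*-commutativeRing

  IsInt : ℚ → ℤ → Set
  IsInt q z = toℚᵘ q ≃ mkℚᵘ z 0

  isInt-0 : IsInt ℚ.0ℚ 0ℤ
  isInt-0 = ℚᵘP.≃-refl

  isInt-1 : IsInt ℚ.1ℚ 1ℤ
  isInt-1 = ℚᵘP.≃-refl

  isInt-+ : ∀ {q r z w} → IsInt q z → IsInt r w → IsInt (q ℚ.+ r) (z ℤ.+ w)
  isInt-+ {q} {r} {z} {w} e1 e2 = ℚᵘP.≃-trans (ℚP.toℚᵘ-homo-+ q r) (ℚᵘP.≃-trans (ℚᵘP.+-cong e1 e2) (*≡* (denominator-1 z w)))
    where denominator-1 : ∀ z w → (z ℤ.* + 1 ℤ.+ w ℤ.* + 1) ℤ.* + 1 ≡ (z ℤ.+ w) ℤ.* + 1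
          denominator-1 = ℤSolver.solve-∀

  isInt-* : ∀ {q r z w} → IsInt q z → IsInt r w → IsInt (q ℚ.* r) (z ℤ.* w)
  isInt-* {q} {r} e1 e2 = ℚᵘP.≃-trans (ℚP.toℚᵘ-homo-* q r) (ℚᵘP.*-cong e1 e2)

  module IntPoly = RelatedPolynomials ℚring ℤring IsInt isInt-0 isInt-1 isInt-+ isInt-*

  toℚᵘ-/ : ∀ i m .{{_ : ℕ.NonZero m}} → toℚᵘ (i ℚ./ m) ≃ mkℚᵘ i (m ∸ 1)
  toℚᵘ-/ i (suc k) = ℚP.toℚᵘ-fromℚᵘ (mkℚᵘ i k)

  toQ-^P : ∀ K (g : PZ.Pol) n → IntPoly.Related K (toQ g PQ.^P n) (g PZ.^P n)
  toQ-^P K g = IntPoly.related-^ K (λ a b _ _ → toℚᵘ-/ (g a b) 1)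

  private
    module QA = RingArithmetic ℚring

  isInt-fromN : ∀ n → IsInt (QA.fromN n) (+ n)
  isInt-fromN zero = isInt-0
  isInt-fromN (suc n) = P.subst (IsInt (QA.fromN (suc n))) (P.cong +_ (ℕP.+-comm n 1)) (isInt-+ (isInt-fromN n) isInt-1)

  suc[n!∸1] : ∀ m → suc (m ! ∸ 1) ≡ m !
  suc[n!∸1] m = ℕP.m+[n∸m]≡n {1} {m !} (ℕ.>-nonZero⁻¹ (m !) {{m ℕP.!≢0}})

  invFact-divided : ∀ n a → a ≤ n → invFact a ℚ.* invFact (n ∸ a) ≡ QA.fromN (Binomial.bin n a) ℚ.* invFact n
  invFact-divided n a a≤n = ℚP.toℚᵘ-injective (ℚᵘP.≃-trans (ℚP.toℚᵘ-homo-* (invFact a) (invFact (n ∸ a)))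
      (ℚᵘP.≃-trans (ℚᵘP.*-cong (toℚᵘ-/ 1ℤ (a !) {{a ℕP.!≢0}}) (toℚᵘ-/ 1ℤ ((n ∸ a) !) {{(n ∸ a) ℕP.!≢0}}))
      (ℚᵘP.≃-trans (*≡* cross)
      (ℚᵘP.≃-sym (ℚᵘP.≃-trans (ℚP.toℚᵘ-homo-* (QA.fromN (Binomial.bin n a)) (invFact n))
         (ℚᵘP.*-cong (isInt-fromN (Binomial.bin n a)) (toℚᵘ-/ 1ℤ (n !) {{n ℕP.!≢0}})))))))
    where
      A B c : ℕ
      A = suc (a ! ∸ 1)
      B = suc ((n ∸ a) ! ∸ 1)
      c = Binomial.bin n a
      factorials : 1 ℕ.* suc (n ! ∸ 1) ≡ (c ℕ.* 1) ℕ.* (A ℕ.* B)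
      factorials = P.trans (ℕP.*-identityˡ _) (P.trans (suc[n!∸1] n)
        (P.trans (P.sym (P.subst (λ m → Binomial.bin m a ℕ.* (a ! ℕ.* (n ∸ a) !) ≡ m !) (ℕP.m+[n∸m]≡n a≤n) (Binomial.fact-bin a (n ∸ a))))
          (P.sym (P.cong₂ ℕ._*_ (ℕP.*-identityʳ c) (P.cong₂ ℕ._*_ (suc[n!∸1] a) (suc[n!∸1] (n ∸ a)))))))
      cross : (1ℤ ℤ.* 1ℤ) ℤ.* + (1 ℕ.* suc (n ! ∸ 1)) ≡ (+ c ℤ.* 1ℤ) ℤ.* + (A ℕ.* B)
      cross = P.trans (P.sym (ℤP.pos-* 1 (1 ℕ.* suc (n ! ∸ 1)))) (P.trans (P.cong +_ (P.trans (ℕP.*-identityˡ _) factorials))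
                (P.trans (ℤP.pos-* (c ℕ.* 1) (A ℕ.* B)) (P.cong (ℤ._* + (A ℕ.* B)) (ℤP.pos-* c 1))))

module IntegralTerms {p : ℕ} (pp : Prime p) (g : PZ.Pol) (g0 : g 0 0 ≡ 0ℤ) where
  open IntegersInℚ
  open PrimeFacts pp
  open Reduction pp using (PIntegral)
  private
    module FV = FrobeniusVanishing (IntegersModP.Zmod p) pp (ZmodFacts.char pp)

  term : ℕ → ℕ → ℕ → ℚ
  term n a b = invFact n ℚ.* (toQ g PQ.^P n) a b

  denominator≡n! : ∀ n → suc ((n ! ∸ 1) ℕ.* 1) ≡ n !
  denominator≡n! n = P.trans (P.cong suc (ℕP.*-identityʳ (n ! ∸ 1))) (suc[n!∸1] n)

  term-representative : ∀ n a b → a < p → b < p →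
    toℚᵘ (term n a b) ≃ mkℚᵘ (1ℤ ℤ.* (g PZ.^P n) a b) ((n ! ∸ 1) ℕ.* 1)
  term-representative n a b a<p b<p =
    ℚᵘP.≃-trans (ℚP.toℚᵘ-homo-* (invFact n) _) (ℚᵘP.*-cong (toℚᵘ-/ 1ℤ (n !) {{n ℕP.!≢0}}) (toQ-^P p g n a b a<p b<p))

  -- for n < p the denominator n! is prime to p; for p ≤ n < 2p-1 we have
  -- n! = p·m with p ∤ m, while (g^n)(a,b) ≡ 0 mod p cancels the p
  term-integral : ∀ n → n < 2 ℕ.* p ∸ 1 → ∀ a b → a < p → b < p → PIntegral (term n a b)
  term-integral n n<2p-1 a b a<p b<p with n <? p
  ... | yes n<p = _ , term-representative n a b a<p b<p , P.subst (λ z → ¬ p ℕD.∣ z) (P.sym (denominator≡n! n)) (¬p∣small! n n<p)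
  ... | no n≮p = mkℚᵘ c′ (m ∸ 1) , ℚᵘP.≃-trans (term-representative n a b a<p b<p) (*≡* cancel-p)
                 , P.subst (λ z → ¬ p ℕD.∣ z) (P.sym (suc[m∸1] m ¬p∣m)) ¬p∣m
    where
      c : ℤ
      c = (g PZ.^P n) a b
      p≤n : p ≤ n
      p≤n = ℕP.≮⇒≥ n≮p
      p∣c : + p ℤS.∣ c
      p∣c = ℤS.∣ᵤ⇒∣ (IntegersModP.≈0⇒dv p {c}
              (IntegersModP.un (FV.^n-vanishes g (IntegersModP.mk (IntegersModP.≈-reflexive p g0)) n p≤n a b a<p b<p)))
      c′ : ℤ
      c′ = ℤS._∣_.quotient p∣c
      j<p : n ∸ p < p
      j<p = ℕP.+-cancelˡ-< p (n ∸ p) p (P.subst (_< p ℕ.+ p) (P.sym (ℕP.m+[n∸m]≡n p≤n))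
              (ℕP.<-≤-trans n<2p-1 (ℕP.≤-trans (ℕP.m∸n≤m (2 ℕ.* p) 1) (ℕP.≤-reflexive (P.cong (p ℕ.+_) (ℕP.+-identityʳ p))))))
      m : ℕ
      m = proj₁ (factorial-p+j (n ∸ p) j<p)
      ¬p∣m : ¬ p ℕD.∣ m
      ¬p∣m = proj₂ (proj₂ (factorial-p+j (n ∸ p) j<p))
      n!≡p*m : n ! ≡ p ℕ.* m
      n!≡p*m = P.trans (P.cong _! (P.sym (ℕP.m+[n∸m]≡n p≤n))) (proj₁ (proj₂ (factorial-p+j (n ∸ p) j<p)))
      suc[m∸1] : ∀ m → ¬ p ℕD.∣ m → suc (m ∸ 1) ≡ m
      suc[m∸1] zero nd = ⊥-elim (nd (ℕD._∣0 p))
      suc[m∸1] (suc m) _ = P.refl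
      cancel-p : (1ℤ ℤ.* c) ℤ.* + suc (m ∸ 1) ≡ c′ ℤ.* + suc ((n ! ∸ 1) ℕ.* 1)
      cancel-p = P.trans (P.cong₂ (λ u v → (1ℤ ℤ.* u) ℤ.* + v) (ℤS._∣_.equality p∣c) (suc[m∸1] m ¬p∣m))
                   (P.trans (regroup c′ (+ p) (+ m))
                     (P.cong (c′ ℤ.*_) (P.trans (P.sym (ℤP.pos-* p m)) (P.cong +_ (P.trans (P.sym n!≡p*m) (P.sym (denominator≡n! n)))))))
        where regroup : ∀ c P M → (1ℤ ℤ.* (c ℤ.* P)) ℤ.* M ≡ c ℤ.* (P ℤ.* M)
              regroup = ℤSolver.solve-∀

module Assembly {p : ℕ} (pp : Prime p) (p≢2 : p ≢ 2) (g : PZ.Pol) (g0 : g 0 0 ≡ 0ℤ) where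
  open IntegersInℚ
  open PrimeFacts pp
  open IntegralTerms pp g g0
  open Reduction pp
  open IntegersModP p using (Zmod; _≋_; mk)
  private
    module Z = CommutativeRing Zmod
    module ZA = RingArithmetic Zmod
    module ZΣ = FiniteSums Zmod
    module ZT = Bivariate.Truncation Zmod p
    module ZTA = RingArithmetic ZT.truncatedRing
    module ZPS = PowerSumsModP Zmod pp (ZmodFacts.char pp) (ZmodFacts.cancelN pp)
    module QA = RingArithmetic ℚring
    module QΣ = FiniteSums ℚring
    module QB = Bivariate ℚring
    module QT = QB.Truncation p
    module QTA = RingArithmetic QT.truncatedRing
    module QTR = CommutativeRing QT.truncatedRing
    module QPS = PowerSums ℚring
    module ReducedPoly = RelatedPolynomials ℚring Zmod Reduces reduces-0 reduces-1 reduces-+ reduces-* p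
  open QT using (_≈T_)

  M : ℕ
  M = 2 ℕ.* p ∸ 2

  2p-1≡1+M : 2 ℕ.* p ∸ 1 ≡ suc M
  2p-1≡1+M = lemma (2 ℕ.* p) (ℕP.≤-trans 1<p (ℕP.m≤m+n p (p ℕ.+ 0)))
    where lemma : ∀ x → 2 ≤ x → x ∸ 1 ≡ suc (x ∸ 2)
          lemma (suc (suc y)) _ = P.refl
          lemma (suc zero) (s≤s ())

  M≡[p-1]+[p-1] : M ≡ (p ∸ 1) ℕ.+ (p ∸ 1)
  M≡[p-1]+[p-1] = P.trans (P.cong (λ q → 2 ℕ.* q ∸ 2) ZPS.p≡1+[p-1]) (double (p ∸ 1))
    where double : ∀ k → 2 ℕ.* suc k ∸ 2 ≡ k ℕ.+ k
          double k = P.trans (P.cong (λ z → (k ℕ.+ z) ∸ 1) (ℕP.*-identityˡ (suc k))) (P.cong (_∸ 1) (ℕP.+-suc k k))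

  p-1<M : p ∸ 1 < M
  p-1<M = P.subst (p ∸ 1 <_) (P.sym M≡[p-1]+[p-1])
            (P.subst (_≤ (p ∸ 1) ℕ.+ (p ∸ 1)) (ℕP.+-comm (p ∸ 1) 1) (ℕP.+-monoʳ-≤ (p ∸ 1) ZPS.1≤p-1))

  p-1<p : p ∸ 1 < p
  p-1<p = P.subst (p ∸ 1 <_) (P.sym ZPS.p≡1+[p-1]) (ℕP.n<1+n (p ∸ 1))

  G : PQ.Pol
  G = toQ g

  G-nilpotent : ∀ m → suc M ≤ m → QTA.pw G m ≈T PQ.zeroP
  G-nilpotent m 1+M≤m a b a<p b<p =
    P.trans (P.cong (λ f → f a b) (QT.pw≡^P G m))
            (Orders.power-vanishes ℚring {G} (P.cong (ℚ._/ 1) g0) p m (P.subst (_≤ m) (P.sym 2p-1≡1+M) 1+M≤m) a b a<p b<p)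

  open ExponentialPowers ℚring p
  open Substitution G M G-nilpotent
  open DividedPowers invFact P.refl invFact-divided

  expQ≈eval : expQ p g ≈T eval (expCoeff 1)
  expQ≈eval a b _ _ =
    P.trans (P.cong (λ k → PQ.sumP k (λ n → PQ.scale (invFact n) (G PQ.^P n)) a b) 2p-1≡1+M)
    (P.trans (QB.sumP-at (suc M) (λ n → PQ.scale (invFact n) (G PQ.^P n)) a b)
    (P.trans (QΣ.Σ-≡ (suc M) (λ n _ → P.cong (ℚ._* (G PQ.^P n) a b) (P.sym (expCoeff-1 n))))
             (P.sym (QB.sumP-at (suc M) (λ n → PQ.scale (expCoeff 1 n) (G PQ.^P n)) a b))))
    where
      expCoeff-1 : ∀ n → expCoeff 1 n ≡ invFact n
      expCoeff-1 n = P.trans (P.cong (ℚ._* invFact n) (P.trans (QA.pw-cong n (ℚP.+-identityˡ ℚ.1ℚ)) (QA.pw-one n)))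
                             (ℚP.*-identityˡ (invFact n))

  σ : ℕ → ℚ
  σ n = QPS.powerSum p n

  W : ℕ → ℕ → ℚ
  W a b = PQ.sumTo (suc M) (λ n → (σ n ℚ.* invFact n) ℚ.* (G PQ.^P n) a b)

  sum-of-exp-powers : ∀ a b → a < p → b < p → PQ.sumP p (λ i → expQ p g PQ.^P i) a b ≡ W a b
  sum-of-exp-powers a b a<p b<p =
    P.trans (QB.sumP-at p (λ i → expQ p g PQ.^P i) a b)
    (P.trans (QΣ.Σ-≡ p (λ i _ → P.trans (exp-powers i a b a<p b<p) (QB.sumP-at (suc M) (λ n → PQ.scale (expCoeff i n) (G PQ.^P n)) a b)))
    (P.trans (QΣ.Σ-swap p (suc M) (λ i n → expCoeff i n ℚ.* (G PQ.^P n) a b))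
             (QΣ.Σ-≡ (suc M) (λ n _ → P.trans (P.sym (QΣ.Σ-*ʳ p ((G PQ.^P n) a b) (λ i → expCoeff i n)))
                (P.cong (ℚ._* (G PQ.^P n) a b) (P.sym (QΣ.Σ-*ʳ p (invFact n) (λ i → QA.pw (QA.fromN i) n))))))))
    where
      exp-powers : ∀ i → (expQ p g PQ.^P i) ≈T eval (expCoeff i)
      exp-powers i = QTR.trans (QTR.reflexive (P.sym (QT.pw≡^P (expQ p g) i)))
                       (QTR.trans (QTA.pw-cong i expQ≈eval) (exp-power i))

  x : ℕ → ℕ → ℕ → ℤ
  x n a b = redQ p (term n a b)

  x-reduces : ∀ n → n < 2 ℕ.* p ∸ 1 → ∀ a b → a < p → b < p → Reduces (term n a b) (x n a b)
  x-reduces n n<2p-1 a b a<p b<p = redQ-reduces (term-integral n n<2p-1 a b a<p b<p)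

  exp-reduces : ReducedPoly.Related (expQ p g) (E₁ p g)
  exp-reduces a b a<p b<p = redQ-reduces (integral (reduces-≡ (P.sym (QB.sumP-at (2 ℕ.* p ∸ 1) _ a b))
                              (ReducedPoly.related-Σ (2 ℕ.* p ∸ 1) (λ n n< → x-reduces n n< a b a<p b<p))))

  LHS-reduces : ReducedPoly.Related (PQ.sumP p (λ i → expQ p g PQ.^P i)) (PZ.sumP p (λ i → E₁ p g PZ.^P i))
  LHS-reduces = ReducedPoly.related-sumP p (λ i _ → ReducedPoly.related-^ exp-reduces i)

  W-reduces : ∀ a b → a < p → b < p → Reduces (W a b) (PZ.sumTo (suc M) (λ n → ZPS.σ n ℤ.* x n a b))
  W-reduces a b a<p b<p = ReducedPoly.related-Σ (suc M) (λ n n<1+M →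
      reduces-≡ (P.sym (ℚP.*-assoc (σ n) (invFact n) ((G PQ.^P n) a b)))
        (reduces-* (σ-reduces n) (x-reduces n (P.subst (n <_) (P.sym 2p-1≡1+M) n<1+M) a b a<p b<p)))
    where
      numeral-reduces : ∀ i → Reduces (QA.fromN i) (ZA.fromN i)
      numeral-reduces zero = reduces-0
      numeral-reduces (suc i) = reduces-+ (numeral-reduces i) reduces-1
      power-reduces : ∀ {q z} → Reduces q z → ∀ n → Reduces (QA.pw q n) (ZA.pw z n)
      power-reduces r zero = reduces-1
      power-reduces r (suc n) = reduces-* (power-reduces r n) r
      σ-reduces : ∀ n → Reduces (σ n) (ZPS.σ n)
      σ-reduces n = ReducedPoly.related-Σ p (λ i _ → power-reduces (numeral-reduces i) n)

  module Coefficient (a b : ℕ) (a<p : a < p) (b<p : b < p) where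
    open SetoidReasoning Z.setoid

    h : ℕ → ℤ
    h n = ZPS.σ n ℤ.* x n a b

    two-terms : PZ.sumTo (suc M) h ≋ h (p ∸ 1) ℤ.+ h M
    two-terms = Z.+-congʳ {h M} (ZΣ.Σ-single M (p ∸ 1) h vanishing p-1<M)
      where vanishing : ∀ n → n < M → n ≢ p ∸ 1 → h n ≋ 0ℤ
            vanishing n n<M ne = Z.trans (Z.*-congʳ {x n a b} (ZPS.σ-vanishes n (P.subst (n <_) M≡[p-1]+[p-1] n<M) ne))
                                         (Z.zeroˡ (x n a b))

    -- σ(p-1) ≡ (p-1)! cancels the denominator of g^(p-1)/(p-1)!
    middle-term : h (p ∸ 1) ≋ (g PZ.^P (p ∸ 1)) a b
    middle-term = begin
        ZPS.σ (p ∸ 1) ℤ.* x (p ∸ 1) a b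
      ≈⟨ Z.*-congʳ {x (p ∸ 1) a b} (ZPS.σ-p-1≈factorial p≢2) ⟩
        ZA.fromN ((p ∸ 1) !) ℤ.* x (p ∸ 1) a b
      ≡⟨ P.trans (ℤP.*-comm (ZA.fromN ((p ∸ 1) !)) (x (p ∸ 1) a b))
                 (P.cong (x (p ∸ 1) a b ℤ.*_) (P.trans (ZmodFacts.fromN≡ pp ((p ∸ 1) !)) (P.cong +_ (P.sym (denominator≡n! (p ∸ 1)))))) ⟩
        x (p ∸ 1) a b ℤ.* + suc (((p ∸ 1) ! ∸ 1) ℕ.* 1)
      ≈⟨ reduces-representative (x-reduces (p ∸ 1) (P.subst (p ∸ 1 <_) (P.sym 2p-1≡1+M) (ℕP.m<n⇒m<1+n p-1<M)) a b a<p b<p)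
           (term-representative (p ∸ 1) a b a<p b<p)
           (P.subst (λ z → ¬ p ℕD.∣ z) (P.sym (denominator≡n! (p ∸ 1))) (¬p∣small! (p ∸ 1) p-1<p)) ⟩
        1ℤ ℤ.* (g PZ.^P (p ∸ 1)) a b
      ≡⟨ ℤP.*-identityˡ _ ⟩
        (g PZ.^P (p ∸ 1)) a b
      ∎

    -- σ(2p-2) ≡ -1, and x(M) is by definition powDivFact, the reduction of g^(2p-2)/(2p-2)!
    top-term : h M ≋ ℤ.- (powDivFact p g a b)
    top-term = Z.trans (Z.*-congʳ {x M a b} (Z.trans (Z.reflexive (P.cong ZPS.σ M≡[p-1]+[p-1])) ZPS.σ-2p-2))
                       (RingProps.-1*x≈-x Z.ring (powDivFact p g a b))

    power-of-lift : ∀ f → g ≈Λ[ p ] f → (g PZ.^P (p ∸ 1)) a b ≋ (f PZ.^P (p ∸ 1)) a b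
    power-of-lift f g≈f = Z.trans (Z.sym (ZT.pw≈^P g (p ∸ 1) a b a<p b<p))
                            (Z.trans (ZTA.pw-cong (p ∸ 1) (λ a b x y → mk (g≈f a b x y)) a b a<p b<p)
                                     (ZT.pw≈^P f (p ∸ 1) a b a<p b<p))

    collapse : ∀ f → g ≈Λ[ p ] f →
      PZ.sumTo (suc M) h ≋ ((f PZ.^P (p ∸ 1)) PZ.⊕ negP (powDivFact p g)) a b
    collapse f g≈f = Z.trans two-terms (Z.+-cong (Z.trans middle-term (power-of-lift f g≈f)) top-term)

lemma4p4 : (p : ℕ) → Prime p → p ≢ 2 →
           (f : PZ.Pol) → f 0 0 ≡[ p ] 0ℤ →
           (g : PZ.Pol) → g ≈Λ[ p ] f → g 0 0 ≡ 0ℤ →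
           PZ.sumP p (λ i → E₁ p g PZ.^P i)
             ≈Λ[ p ] ((f PZ.^P (p ∸ 1)) PZ.⊕ negP (powDivFact p g))
lemma4p4 p pp p≢2 f _ g g≈f g0 a b a<p b<p = IntegersModP.un (reduces-unique lhs rhs)
  where
    open Assembly pp p≢2 g g0
    open Coefficient a b a<p b<p using (collapse)
    open Reduction pp using (Reduces; reduces-unique; reduces-≡; reduces-resp)
    lhs : Reduces (PQ.sumP p (λ i → expQ p g PQ.^P i) a b) (PZ.sumP p (λ i → E₁ p g PZ.^P i) a b)
    lhs = LHS-reduces a b a<p b<p
    rhs : Reduces (PQ.sumP p (λ i → expQ p g PQ.^P i) a b) (((f PZ.^P (p ∸ 1)) PZ.⊕ negP (powDivFact p g)) a b)
    rhs = reduces-≡ (P.sym (sum-of-exp-powers a b a<p b<p))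
                    (reduces-resp (collapse f g≈f) (W-reduces a b a<p b<p))
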